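{- The following two pairs of sequences are Bailey pairs relative to $q^2$ (in each, $r$ denotes the integer determined by the residue of $k$ mod 3): (1) $\alpha_k=\frac{1-q^{k+1}}{1-q}\bigl(q^{3r^2-2r}-q^{3r^2-r}\bigr)$ if $k=3r-1$, $\alpha_k=\frac{1-q^{k+1}}{1-q}q^{3r^2+r}$ if $k=3r$, $\alpha_k=-\frac{1-q^{k+1}}{1-q}q^{3r^2+2r}$ if $k=3r+1$; and $\beta_k=\frac{q^{k^2+k}(1+q)}{(q^2)_{2k}(1+q^{k+1})}$. (2) $\alpha_k=\frac{1-q^{k+1}}{1-q}\bigl(q^{6r^2-r}-q^{6r^2-2r}\bigr)$ if $k=3r-1$, $\alpha_k=\frac{1-q^{k+1}}{1-q}q^{6r^2+2r}$ if $k=3r$, $\alpha_k=-\frac{1-q^{k+1}}{1-q}q^{6r^2+7r+2}$ if $k=3r+1$; and $\beta_k=\frac{1+q}{(q^2)_{2k}(1+q^{k+1})}$.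
   Context: $q$ is an indeterminate; $(a)_n=\prod_{k=1}^n(1-aq^{k-1})$. A pair $(\alpha_n,\beta_n)_{n\ge0}$ is a Bailey pair relative to $a$ if $\beta_n=\sum_{k=0}^n\frac{\alpha_k}{(q)_{n-k}(aq)_{n+k}}$ for all $n\ge0$. -}

module Defs where

open import Data.Nat as ℕ using (ℕ; zero; suc; _∸_; _≤ᵇ_; _≡ᵇ_)
open import Data.Nat.DivMod using (_%_; _/_)
open import Data.Integer as ℤ using (ℤ; +_; -_; _+_; _*_)
open import Data.Bool using (if_then_else_)
open import Data.Product using (_×_)
open import Relation.Binary.PropositionalEquality using (_≡_)

-- Formal power series in q over ℤ, represented by coefficient sequences.
-- All q-series in the statement (including the Bailey-pair identity)
-- are interpreted in ℤ[[q]].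

PS : Set
PS = ℕ → ℤ

_≈_ : PS → PS → Set
f ≈ g = ∀ m → f m ≡ g m

infix 4 _≈_
infixl 6 _⊕_ _⊖_
infixl 7 _⊛_

sumℤ : ℕ → (ℕ → ℤ) → ℤ
sumℤ zero    h = h 0
sumℤ (suc n) h = sumℤ n h + h (suc n)

one : PS
one zero    = + 1
one (suc _) = + 0

X^ : ℕ → PS
X^ e m = if m ≡ᵇ e then + 1 else + 0

_⊕_ : PS → PS → PS
(f ⊕ g) m = f m + g m

neg : PS → PS
neg f m = - f m

_⊖_ : PS → PS → PS
f ⊖ g = f ⊕ neg g

_⊛_ : PS → PS → PS
(f ⊛ g) m = sumℤ m (λ i → f i * g (m ∸ i))

sumPS : ℕ → (ℕ → PS) → PS
sumPS n F m = sumℤ n (λ k → F k m)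

prodPS : ℕ → (ℕ → PS) → PS
prodPS zero    F = one
prodPS (suc n) F = prodPS n F ⊛ F n

poch : PS → ℕ → PS
poch a n = prodPS n (λ k → one ⊖ a ⊛ X^ k)

-- Multiplicative inverse in ℤ[[q]] of a series f with constant term 1:
-- g_0 = 1, g_m = - Σ_{i=1}^{m} f_i g_{m-i}.
-- invTab f n j is the correct coefficient g_j for every j ≤ n.
invTab : PS → ℕ → ℕ → ℤ
invTab f zero    j = + 1
invTab f (suc n) j =
  if j ≤ᵇ n then invTab f n j
  else - sumℤ n (λ i → f (suc i) * invTab f n (n ∸ i))

inv : PS → PS
inv f m = invTab f m m

BaileyPair : PS → (ℕ → PS) → (ℕ → PS) → Set
BaileyPair a α β =
  ∀ n → β n ≈ sumPS n (λ k → α k ⊛ inv (poch (X^ 1) (n ∸ k))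
                                   ⊛ inv (poch (a ⊛ X^ 1) (n ℕ.+ k)))

fac : ℕ → PS
fac k = (one ⊖ X^ (suc k)) ⊛ inv (one ⊖ X^ 1)

-- Case k ≡ 0 (mod 3), k = 3r; case k ≡ 1, k = 3r+1; case k ≡ 2, k = 3r-1
-- (so r = k/3 + 1 in the last case; note r ≥ 1 there, so the
-- natural subtractions below are exact).

α₁ : ℕ → PS
α₁ k with k % 3
... | 0       = fac k ⊛ X^ (3 ℕ.* r ℕ.* r ℕ.+ r)               where r = k / 3
... | 1       = neg (fac k ⊛ X^ (3 ℕ.* r ℕ.* r ℕ.+ 2 ℕ.* r))   where r = k / 3
... | _       = fac k ⊛ (X^ (3 ℕ.* r ℕ.* r ∸ 2 ℕ.* r) ⊖ X^ (3 ℕ.* r ℕ.* r ∸ r))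
                where r = suc (k / 3)

β₁ : ℕ → PS
β₁ k = X^ (k ℕ.* k ℕ.+ k) ⊛ (one ⊕ X^ 1) ⊛ inv (poch (X^ 2) (2 ℕ.* k))
       ⊛ inv (one ⊕ X^ (suc k))

α₂ : ℕ → PS
α₂ k with k % 3
... | 0       = fac k ⊛ X^ (6 ℕ.* r ℕ.* r ℕ.+ 2 ℕ.* r)                where r = k / 3
... | 1       = neg (fac k ⊛ X^ (6 ℕ.* r ℕ.* r ℕ.+ 7 ℕ.* r ℕ.+ 2))   where r = k / 3
... | _       = fac k ⊛ (X^ (6 ℕ.* r ℕ.* r ∸ r) ⊖ X^ (6 ℕ.* r ℕ.* r ∸ 2 ℕ.* r))
                where r = suc (k / 3)

β₂ : ℕ → PS
β₂ k = (one ⊕ X^ 1) ⊛ inv (poch (X^ 2) (2 ℕ.* k)) ⊛ inv (one ⊕ X^ (suc k))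

{-# OPTIONS --safe #-}

-- Multiplying the Bailey relation by (q)_{2n+2} and splitting
-- (q)_{2n+2} = (q)_{n-k} (1 - q) (1 - q²) (q³)_{n+k} [2n+2, n-k], both pairs reduce to
-- polynomial identities  Σ_{k ≤ n} (1 - q^{k+1}) D_k [2n+2, n-k] = c_n (1 - q^{n+1}),  where
-- α_k = D_k (1 - q^{k+1}) / (1 - q) and c_n = q^{n²+n}, resp. 1.
-- Write D_k = f(k+1) - q^{-k-1} f(-k-1) for a two-sided sequence f with f(j+3) = q^{Lj+K} f(j).
-- Pairing the equal q-binomials [2N, N-j] and [2N, N+j] (N = n + 1), the left side becomes
-- Θ_0(2N, N) - q^{N-LN-K} Θ_{L-1}(2N, N+3), where Θ_a(M, c) = Σ_m f(c-m) q^{am} [M, m].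
-- The two q-Pascal rules and the quasi-periodicity of f give recurrences for Θ in M, c and a,
-- and a joint induction on N shows that both of these values are single monomials.

module Submission where

open import Defs
open import Data.Bool using (true; false; T)
open import Data.Empty using (⊥-elim)
open import Function using (_∘_)
open import Data.Maybe using (Maybe; just; nothing)
open import Data.Nat using (ℕ; zero; suc; _∸_; _≤_; _<_; _≤ᵇ_; _≡ᵇ_; z≤n; s≤s)
import Data.Nat.Properties as ℕ
open import Data.Nat.DivMod using (_%_; _/_; m≡m%n+[m/n]*n; m%n<n)
open import Data.Nat.Tactic.RingSolver using (solve-∀)
open import Data.Integer as ℤ using (ℤ; +_; -[1+_]; -_)
import Data.Integer.Properties as ℤ
open import Data.Integer.Solver using (module +-*-Solver)
open import Data.Product using (_×_; _,_)
open import Data.Sum using (inj₁; inj₂)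
open import Data.Unit using (tt)
open import Relation.Binary.PropositionalEquality
  using (_≡_; _≢_; refl; sym; trans; cong; cong₂; subst; module ≡-Reasoning)
open import Relation.Nullary using (yes; no)
open import Algebra.Bundles using (CommutativeRing)
open import Algebra.Structures using (IsCommutativeRing)
open import Algebra.Solver.Ring.AlmostCommutativeRing
  using (_-Raw-AlmostCommutative⟶_; fromCommutativeRing)
import Algebra.Solver.Ring
import Relation.Binary.Reasoning.Setoid as SetoidReasoning

module SumℤProperties where

  open import Data.Integer using (_+_; _*_)
  open ≡-Reasoning

  sumℤ-cong-≤ : ∀ n {h h′ : ℕ → ℤ} → (∀ i → i ≤ n → h i ≡ h′ i) → sumℤ n h ≡ sumℤ n h′
  sumℤ-cong-≤ zero    eq = eq 0 z≤n
  sumℤ-cong-≤ (suc n) eq =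
    cong₂ _+_ (sumℤ-cong-≤ n λ i i≤n → eq i (ℕ.m≤n⇒m≤1+n i≤n)) (eq (suc n) ℕ.≤-refl)

  sumℤ-cong : ∀ n {h h′ : ℕ → ℤ} → (∀ i → h i ≡ h′ i) → sumℤ n h ≡ sumℤ n h′
  sumℤ-cong n eq = sumℤ-cong-≤ n λ i _ → eq i

  sumℤ-zero : ∀ n (h : ℕ → ℤ) → (∀ i → i ≤ n → h i ≡ + 0) → sumℤ n h ≡ + 0
  sumℤ-zero zero    h eq = eq 0 z≤n
  sumℤ-zero (suc n) h eq =
    cong₂ _+_ (sumℤ-zero n h λ i i≤n → eq i (ℕ.m≤n⇒m≤1+n i≤n)) (eq (suc n) ℕ.≤-refl)

  sumℤ-distrib-+ : ∀ n (h h′ : ℕ → ℤ) → sumℤ n (λ i → h i + h′ i) ≡ sumℤ n h + sumℤ n h′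
  sumℤ-distrib-+ zero    h h′ = refl
  sumℤ-distrib-+ (suc n) h h′ =
    trans (cong (_+ (h (suc n) + h′ (suc n))) (sumℤ-distrib-+ n h h′))
          (+-interchange (sumℤ n h) (sumℤ n h′) (h (suc n)) (h′ (suc n)))
    where
    open +-*-Solver
    +-interchange : ∀ a b c d → (a + b) + (c + d) ≡ (a + c) + (b + d)
    +-interchange = solve 4 (λ a b c d → (a :+ b) :+ (c :+ d) := (a :+ c) :+ (b :+ d)) refl

  *-distribˡ-sumℤ : ∀ n c (h : ℕ → ℤ) → c * sumℤ n h ≡ sumℤ n (λ i → c * h i)
  *-distribˡ-sumℤ zero    c h = refl
  *-distribˡ-sumℤ (suc n) c h =
    trans (ℤ.*-distribˡ-+ c (sumℤ n h) (h (suc n))) (cong (_+ c * h (suc n)) (*-distribˡ-sumℤ n c h))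

  *-distribʳ-sumℤ : ∀ n c (h : ℕ → ℤ) → sumℤ n h * c ≡ sumℤ n (λ i → h i * c)
  *-distribʳ-sumℤ n c h =
    trans (ℤ.*-comm (sumℤ n h) c) (trans (*-distribˡ-sumℤ n c h) (sumℤ-cong n λ i → ℤ.*-comm c (h i)))

  neg-distrib-sumℤ : ∀ n (h : ℕ → ℤ) → - sumℤ n h ≡ sumℤ n (λ i → - h i)
  neg-distrib-sumℤ zero    h = refl
  neg-distrib-sumℤ (suc n) h =
    trans (ℤ.neg-distrib-+ (sumℤ n h) (h (suc n))) (cong (_+ - h (suc n)) (neg-distrib-sumℤ n h))

  sumℤ-cons : ∀ n (h : ℕ → ℤ) → sumℤ (suc n) h ≡ h 0 + sumℤ n (λ i → h (suc i))
  sumℤ-cons zero    h = refl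
  sumℤ-cons (suc n) h =
    trans (cong (_+ h (suc (suc n))) (sumℤ-cons n h)) (ℤ.+-assoc (h 0) _ (h (suc (suc n))))

  sumℤ-reverse : ∀ n (h : ℕ → ℤ) → sumℤ n h ≡ sumℤ n (λ i → h (n ∸ i))
  sumℤ-reverse zero    h = refl
  sumℤ-reverse (suc n) h = begin
    sumℤ n h + h (suc n)                           ≡⟨ cong (_+ h (suc n)) (sumℤ-reverse n h) ⟩
    sumℤ n (λ i → h (n ∸ i)) + h (suc n)           ≡⟨ ℤ.+-comm _ (h (suc n)) ⟩
    h (suc n) + sumℤ n (λ i → h (n ∸ i))           ≡⟨ sumℤ-cons n (λ i → h (suc n ∸ i)) ⟨
    sumℤ (suc n) (λ i → h (suc n ∸ i))             ∎

  sumℤ-triangle : ∀ m (F : ℕ → ℕ → ℤ) →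
    sumℤ m (λ i → sumℤ (m ∸ i) (F i)) ≡ sumℤ m (λ k → sumℤ k (λ i → F i (k ∸ i)))
  sumℤ-triangle zero    F = refl
  sumℤ-triangle (suc m) F = begin
    sumℤ m (λ i → sumℤ (suc m ∸ i) (F i)) + sumℤ (m ∸ m) (F (suc m))
      ≡⟨ cong₂ _+_ (sumℤ-cong-≤ m unsnoc) (sumℤ-singleton (ℕ.n∸n≡0 m)) ⟩
    sumℤ m (λ i → sumℤ (m ∸ i) (F i) + F i (suc m ∸ i)) + F (suc m) (m ∸ m)
      ≡⟨ cong (_+ F (suc m) (m ∸ m)) (sumℤ-distrib-+ m _ _) ⟩
    sumℤ m (λ i → sumℤ (m ∸ i) (F i)) + sumℤ m (λ i → F i (suc m ∸ i)) + F (suc m) (m ∸ m)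
      ≡⟨ ℤ.+-assoc (sumℤ m (λ i → sumℤ (m ∸ i) (F i))) _ _ ⟩
    sumℤ m (λ i → sumℤ (m ∸ i) (F i)) + sumℤ (suc m) (λ i → F i (suc m ∸ i))
      ≡⟨ cong (_+ sumℤ (suc m) (λ i → F i (suc m ∸ i))) (sumℤ-triangle m F) ⟩
    sumℤ m (λ k → sumℤ k (λ i → F i (k ∸ i))) + sumℤ (suc m) (λ i → F i (suc m ∸ i))
      ∎
    where
    unsnoc : ∀ i → i ≤ m → sumℤ (suc m ∸ i) (F i) ≡ sumℤ (m ∸ i) (F i) + F i (suc m ∸ i)
    unsnoc i i≤m rewrite ℕ.+-∸-assoc 1 i≤m = refl
    sumℤ-singleton : ∀ {j} {g : ℕ → ℤ} → j ≡ 0 → sumℤ j g ≡ g j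
    sumℤ-singleton refl = refl

open SumℤProperties

zeroPS : PS
zeroPS _ = + 0

module PowerSeriesRing where

  open import Data.Integer using (_+_; _*_)
  open ≡-Reasoning

  ≈-refl : ∀ {f} → f ≈ f
  ≈-refl m = refl

  ≈-reflexive : ∀ {f g} → f ≡ g → f ≈ g
  ≈-reflexive refl = ≈-refl

  ≈-sym : ∀ {f g} → f ≈ g → g ≈ f
  ≈-sym f≈g m = sym (f≈g m)

  ≈-trans : ∀ {f g h} → f ≈ g → g ≈ h → f ≈ h
  ≈-trans f≈g g≈h m = trans (f≈g m) (g≈h m)

  ⊕-cong : ∀ {f f′ g g′} → f ≈ f′ → g ≈ g′ → f ⊕ g ≈ f′ ⊕ g′
  ⊕-cong f≈f′ g≈g′ m = cong₂ _+_ (f≈f′ m) (g≈g′ m)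

  ⊕-congˡ : ∀ f {g g′} → g ≈ g′ → f ⊕ g ≈ f ⊕ g′
  ⊕-congˡ f g≈g′ m = cong (λ z → f m + z) (g≈g′ m)

  ⊕-congʳ : ∀ g {f f′} → f ≈ f′ → f ⊕ g ≈ f′ ⊕ g
  ⊕-congʳ g f≈f′ m = cong (_+ g m) (f≈f′ m)

  neg-cong : ∀ {f f′} → f ≈ f′ → neg f ≈ neg f′
  neg-cong f≈f′ m = cong -_ (f≈f′ m)

  ⊛-cong : ∀ {f f′ g g′} → f ≈ f′ → g ≈ g′ → f ⊛ g ≈ f′ ⊛ g′
  ⊛-cong f≈f′ g≈g′ m = sumℤ-cong m λ i → cong₂ _*_ (f≈f′ i) (g≈g′ (m ∸ i))

  ⊛-congˡ : ∀ f {g g′} → g ≈ g′ → f ⊛ g ≈ f ⊛ g′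
  ⊛-congˡ f = ⊛-cong (≈-refl {f})

  ⊛-congʳ : ∀ g {f f′} → f ≈ f′ → f ⊛ g ≈ f′ ⊛ g
  ⊛-congʳ g f≈f′ = ⊛-cong f≈f′ (≈-refl {g})

  ⊛-comm : ∀ f g → f ⊛ g ≈ g ⊛ f
  ⊛-comm f g m = begin
    sumℤ m (λ i → f i * g (m ∸ i))                ≡⟨ sumℤ-reverse m _ ⟩
    sumℤ m (λ i → f (m ∸ i) * g (m ∸ (m ∸ i)))    ≡⟨ sumℤ-cong-≤ m swap ⟩
    sumℤ m (λ i → g i * f (m ∸ i))                ∎
    where
    swap : ∀ i → i ≤ m → f (m ∸ i) * g (m ∸ (m ∸ i)) ≡ g i * f (m ∸ i)
    swap i i≤m rewrite ℕ.m∸[m∸n]≡n i≤m = ℤ.*-comm (f (m ∸ i)) (g i)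

  ⊛-assoc : ∀ f g h → (f ⊛ g) ⊛ h ≈ f ⊛ (g ⊛ h)
  ⊛-assoc f g h m = sym (begin
    sumℤ m (λ i → f i * sumℤ (m ∸ i) (λ j → g j * h (m ∸ i ∸ j)))
      ≡⟨ sumℤ-cong m (λ i → *-distribˡ-sumℤ (m ∸ i) (f i) _) ⟩
    sumℤ m (λ i → sumℤ (m ∸ i) (λ j → f i * (g j * h (m ∸ i ∸ j))))
      ≡⟨ sumℤ-triangle m (λ i j → f i * (g j * h (m ∸ i ∸ j))) ⟩
    sumℤ m (λ k → sumℤ k (λ i → f i * (g (k ∸ i) * h (m ∸ i ∸ (k ∸ i)))))
      ≡⟨ sumℤ-cong-≤ m (λ k k≤m → sumℤ-cong-≤ k (regroup k)) ⟩
    sumℤ m (λ k → sumℤ k (λ i → f i * g (k ∸ i) * h (m ∸ k)))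
      ≡⟨ sumℤ-cong m (λ k → *-distribʳ-sumℤ k (h (m ∸ k)) _) ⟨
    sumℤ m (λ k → sumℤ k (λ i → f i * g (k ∸ i)) * h (m ∸ k))
      ∎)
    where
    regroup : ∀ k i → i ≤ k → f i * (g (k ∸ i) * h (m ∸ i ∸ (k ∸ i))) ≡ f i * g (k ∸ i) * h (m ∸ k)
    regroup k i i≤k rewrite ℕ.∸-+-assoc m i (k ∸ i) | ℕ.m+[n∸m]≡n i≤k =
      sym (ℤ.*-assoc (f i) (g (k ∸ i)) (h (m ∸ k)))

  ⊛-distribˡ : ∀ f g h → f ⊛ (g ⊕ h) ≈ f ⊛ g ⊕ f ⊛ h
  ⊛-distribˡ f g h m =
    trans (sumℤ-cong m λ i → ℤ.*-distribˡ-+ (f i) (g (m ∸ i)) (h (m ∸ i))) (sumℤ-distrib-+ m _ _)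

  ⊛-distribʳ : ∀ f g h → (g ⊕ h) ⊛ f ≈ g ⊛ f ⊕ h ⊛ f
  ⊛-distribʳ f g h =
    ≈-trans (⊛-comm (g ⊕ h) f) (≈-trans (⊛-distribˡ f g h) (⊕-cong (⊛-comm f g) (⊛-comm f h)))

  X^-≢ : ∀ {e i} → i ≢ e → X^ e i ≡ + 0
  X^-≢ {e} {i} i≢e with i ≡ᵇ e in i≡ᵇe
  ... | true  = ⊥-elim (i≢e (ℕ.≡ᵇ⇒≡ i e (subst T (sym i≡ᵇe) tt)))
  ... | false = refl

  X^-diagonal : ∀ e → X^ e e ≡ + 1
  X^-diagonal zero    = refl
  X^-diagonal (suc e) = X^-diagonal e

  sumℤ-X^-> : ∀ n e (v : ℕ → ℤ) → n < e → sumℤ n (λ i → X^ e i * v i) ≡ + 0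
  sumℤ-X^-> n e v n<e = sumℤ-zero n _ λ i i≤n →
    trans (cong (_* v i) (X^-≢ λ i≡e → ℕ.<⇒≢ (ℕ.≤-<-trans i≤n n<e) i≡e)) (ℤ.*-zeroˡ (v i))

  sumℤ-X^-≤ : ∀ n e (v : ℕ → ℤ) → e ≤ n → sumℤ n (λ i → X^ e i * v i) ≡ v e
  sumℤ-X^-≤ zero    .zero v z≤n = ℤ.*-identityˡ (v 0)
  sumℤ-X^-≤ (suc n) e v e≤1+n with ℕ.m≤n⇒m<n∨m≡n e≤1+n
  ... | inj₁ (s≤s e≤n) = begin
    sumℤ n (λ i → X^ e i * v i) + X^ e (suc n) * v (suc n)
      ≡⟨ cong₂ _+_ (sumℤ-X^-≤ n e v e≤n) (cong (_* v (suc n)) (X^-≢ (ℕ.<⇒≢ (s≤s e≤n) ∘ sym))) ⟩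
    v e + + 0 * v (suc n)
      ≡⟨ cong (λ z → v e + z) (ℤ.*-zeroˡ (v (suc n))) ⟩
    v e + + 0
      ≡⟨ ℤ.+-identityʳ (v e) ⟩
    v e ∎
  ... | inj₂ refl = begin
    sumℤ n (λ i → X^ e i * v i) + X^ e e * v e
      ≡⟨ cong₂ _+_ (sumℤ-X^-> n e v ℕ.≤-refl) (cong (_* v e) (X^-diagonal e)) ⟩
    + 0 + + 1 * v e
      ≡⟨ ℤ.+-identityˡ (+ 1 * v e) ⟩
    + 1 * v e
      ≡⟨ ℤ.*-identityˡ (v e) ⟩
    v e ∎

  X^-⊛-≥ : ∀ e f m → e ≤ m → (X^ e ⊛ f) m ≡ f (m ∸ e)
  X^-⊛-≥ e f m = sumℤ-X^-≤ m e (λ i → f (m ∸ i))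

  X^-⊛-< : ∀ e f m → m < e → (X^ e ⊛ f) m ≡ + 0
  X^-⊛-< e f m = sumℤ-X^-> m e (λ i → f (m ∸ i))

  one≈X^0 : one ≈ X^ 0
  one≈X^0 zero    = refl
  one≈X^0 (suc m) = refl

  ⊛-identityˡ : ∀ f → one ⊛ f ≈ f
  ⊛-identityˡ f m = trans (⊛-cong one≈X^0 (≈-refl {f}) m) (X^-⊛-≥ 0 f m z≤n)

  isCommutativeRing : IsCommutativeRing _≈_ _⊕_ _⊛_ neg zeroPS one
  isCommutativeRing = record
    { isRing = record
      { +-isAbelianGroup = record
        { isGroup = record
          { isMonoid = record
            { isSemigroup = record
              { isMagma = record
                { isEquivalence = record { refl = λ {f} → ≈-refl {f} ; sym = ≈-sym ; trans = ≈-trans }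
                ; ∙-cong = ⊕-cong }
              ; assoc = λ f g h m → ℤ.+-assoc (f m) (g m) (h m) }
            ; identity = (λ f m → ℤ.+-identityˡ (f m)) , (λ f m → ℤ.+-identityʳ (f m)) }
          ; inverse = (λ f m → ℤ.+-inverseˡ (f m)) , (λ f m → ℤ.+-inverseʳ (f m))
          ; ⁻¹-cong = neg-cong }
        ; comm = λ f g m → ℤ.+-comm (f m) (g m) }
      ; *-cong = ⊛-cong
      ; *-assoc = ⊛-assoc
      ; *-identity = ⊛-identityˡ , (λ f → ≈-trans (⊛-comm f one) (⊛-identityˡ f))
      ; distrib = ⊛-distribˡ , ⊛-distribʳ }
    ; *-comm = ⊛-comm }

open PowerSeriesRing public
  using ( ≈-refl; ≈-reflexive; ≈-sym; ≈-trans; ⊕-cong; ⊕-congˡ; ⊕-congʳ; neg-cong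
        ; ⊛-cong; ⊛-congˡ; ⊛-congʳ; ⊛-comm; ⊛-assoc; ⊛-identityˡ; ⊛-distribˡ
        ; one≈X^0; X^-≢; X^-⊛-≥; X^-⊛-<)

ℤ[[q]] : CommutativeRing _ _
ℤ[[q]] = record { isCommutativeRing = PowerSeriesRing.isCommutativeRing }

module ≈-Reasoning = SetoidReasoning (CommutativeRing.setoid ℤ[[q]])

open CommutativeRing ℤ[[q]] public using ()
  renaming (+-comm to ⊕-comm;
            +-identityˡ to ⊕-identityˡ; +-identityʳ to ⊕-identityʳ;
            *-identityʳ to ⊛-identityʳ; zeroʳ to ⊛-zeroʳ)

module PowerSeriesSolver where

  open import Data.Integer using (_+_; _*_; _≟_; +-*-rawRing)

  constant′ : ℤ → PS
  constant′ c zero    = c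
  constant′ c (suc _) = + 0

  -- The clauses for 0 and 1 make the solver's `con (+ 0)` and `con (+ 1)` reduce
  -- to zeroPS and one, so that its output matches goals stated with them.
  constant : ℤ → PS
  constant (+ 0) = zeroPS
  constant (+ 1) = one
  constant c     = constant′ c

  constant≈constant′ : ∀ c → constant c ≈ constant′ c
  constant≈constant′ (+ 0)           zero    = refl
  constant≈constant′ (+ 0)           (suc m) = refl
  constant≈constant′ (+ 1)           zero    = refl
  constant≈constant′ (+ 1)           (suc m) = refl
  constant≈constant′ (+ suc (suc n)) m       = refl
  constant≈constant′ -[1+ n ]        m       = refl

  constant′-+ : ∀ a b → constant′ (a + b) ≈ constant′ a ⊕ constant′ b
  constant′-+ a b zero    = refl
  constant′-+ a b (suc m) = refl

  constant′-* : ∀ a b → constant′ (a * b) ≈ constant′ a ⊛ constant′ b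
  constant′-* a b zero    = refl
  constant′-* a b (suc m) = sym (begin
    sumℤ (suc m) (λ i → constant′ a i * constant′ b (suc m ∸ i))
      ≡⟨ sumℤ-cons m _ ⟩
    a * + 0 + sumℤ m (λ i → + 0 * constant′ b (m ∸ i))
      ≡⟨ cong₂ _+_ (ℤ.*-zeroʳ a) (sumℤ-zero m _ λ i _ → ℤ.*-zeroˡ (constant′ b (m ∸ i))) ⟩
    + 0 ∎)
    where open ≡-Reasoning

  constant′-neg : ∀ a → constant′ (- a) ≈ neg (constant′ a)
  constant′-neg a zero    = refl
  constant′-neg a (suc m) = refl

  constant-morphism : +-*-rawRing -Raw-AlmostCommutative⟶ fromCommutativeRing ℤ[[q]]
  constant-morphism = record
    { ⟦_⟧    = constant
    ; +-homo = λ a b → homo₂ ⊕-cong a b (constant′-+ a b)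
    ; *-homo = λ a b → homo₂ ⊛-cong a b (constant′-* a b)
    ; -‿homo = λ a → ≈-trans (constant≈constant′ (- a))
                       (≈-trans (constant′-neg a) (neg-cong (≈-sym (constant≈constant′ a))))
    ; 0-homo = ≈-refl
    ; 1-homo = ≈-refl
    }
    where
    homo₂ : ∀ {_∙_ : PS → PS → PS} → (∀ {f f′ g g′} → f ≈ f′ → g ≈ g′ → (f ∙ g) ≈ (f′ ∙ g′)) →
            ∀ {c} a b → constant′ c ≈ (constant′ a ∙ constant′ b) → constant c ≈ (constant a ∙ constant b)
    homo₂ ∙-cong {c} a b eq = ≈-trans (constant≈constant′ c)
      (≈-trans eq (∙-cong (≈-sym (constant≈constant′ a)) (≈-sym (constant≈constant′ b))))

  constant-≟ : ∀ a b → Maybe (constant a ≈ constant b)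
  constant-≟ a b with a ≟ b
  ... | yes refl = just ≈-refl
  ... | no _     = nothing

  open Algebra.Solver.Ring +-*-rawRing (fromCommutativeRing ℤ[[q]]) constant-morphism constant-≟ public

module Inverses where

  open import Data.Integer using (_+_; _*_)

  poch-constant : ∀ a n → a 0 ≡ + 0 → poch a n 0 ≡ + 1
  poch-constant a zero    a₀≡0 = refl
  poch-constant a (suc n) a₀≡0 =
    cong₂ _*_ (poch-constant a n a₀≡0)
              (cong (λ z → + 1 + - z) (trans (cong (_* X^ n 0) a₀≡0) (ℤ.*-zeroˡ (X^ n 0))))

  ⊛-constant-one : ∀ f g → f 0 ≡ + 1 → g 0 ≡ + 1 → (f ⊛ g) 0 ≡ + 1
  ⊛-constant-one f g f₀≡1 g₀≡1 = cong₂ _*_ f₀≡1 g₀≡1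

  invTab-stable : ∀ f n j → j ≤ n → invTab f n j ≡ inv f j
  invTab-stable f zero    .zero z≤n = refl
  invTab-stable f (suc n) j j≤1+n with ℕ.m≤n⇒m<n∨m≡n j≤1+n
  ... | inj₂ refl = refl
  ... | inj₁ (s≤s j≤n) with j ≤ᵇ n in j≤ᵇn
  ...   | true  = invTab-stable f n j j≤n
  ...   | false = ⊥-elim (subst T j≤ᵇn (ℕ.≤⇒≤ᵇ j≤n))

  inv-suc : ∀ f n → inv f (suc n) ≡ - sumℤ n (λ i → f (suc i) * inv f (n ∸ i))
  inv-suc f n with suc n ≤ᵇ n in 1+n≤ᵇn
  ... | true  = ⊥-elim (ℕ.1+n≰n (ℕ.≤ᵇ⇒≤ (suc n) n (subst T (sym 1+n≤ᵇn) tt)))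
  ... | false = cong -_ (sumℤ-cong-≤ n λ i i≤n →
                  cong (f (suc i) *_) (invTab-stable f n (n ∸ i) (ℕ.m∸n≤m n i)))

  ⊛-inverseʳ : ∀ f → f 0 ≡ + 1 → f ⊛ inv f ≈ one
  ⊛-inverseʳ f f₀≡1 zero    = cong (_* + 1) f₀≡1
  ⊛-inverseʳ f f₀≡1 (suc n) = begin
    sumℤ (suc n) (λ i → f i * inv f (suc n ∸ i))  ≡⟨ sumℤ-cons n _ ⟩
    f 0 * inv f (suc n) + S                        ≡⟨ cong (λ z → z * inv f (suc n) + S) f₀≡1 ⟩
    + 1 * inv f (suc n) + S                        ≡⟨ cong (_+ S) (ℤ.*-identityˡ (inv f (suc n))) ⟩
    inv f (suc n) + S                              ≡⟨ cong (_+ S) (inv-suc f n) ⟩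
    - S + S                                        ≡⟨ ℤ.+-inverseˡ S ⟩
    + 0                                            ∎
    where
    open ≡-Reasoning
    S = sumℤ n (λ i → f (suc i) * inv f (n ∸ i))

  ⊛-cancelˡ : ∀ f {a b} → f 0 ≡ + 1 → f ⊛ a ≈ f ⊛ b → a ≈ b
  ⊛-cancelˡ f {a} {b} f₀≡1 fa≈fb = begin
    a                   ≈⟨ ⊛-identityˡ a ⟨
    one ⊛ a             ≈⟨ ⊛-congʳ a f⁻¹f≈1 ⟨
    (inv f ⊛ f) ⊛ a     ≈⟨ ⊛-assoc (inv f) f a ⟩
    inv f ⊛ (f ⊛ a)     ≈⟨ ⊛-congˡ (inv f) fa≈fb ⟩
    inv f ⊛ (f ⊛ b)     ≈⟨ ⊛-assoc (inv f) f b ⟨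
    (inv f ⊛ f) ⊛ b     ≈⟨ ⊛-congʳ b f⁻¹f≈1 ⟩
    one ⊛ b             ≈⟨ ⊛-identityˡ b ⟩
    b                   ∎
    where
    open ≈-Reasoning
    f⁻¹f≈1 : inv f ⊛ f ≈ one
    f⁻¹f≈1 = ≈-trans (⊛-comm (inv f) f) (⊛-inverseʳ f f₀≡1)

open Inverses public

open import Data.Nat using (_+_; _*_)
open PowerSeriesSolver using (solve; con; _:+_; _:*_; _:-_; :-_; _:=_)

-- Monomials

X^-+ˡ : ∀ a {b} k → X^ (a + b) (a + k) ≡ X^ b k
X^-+ˡ zero    k = refl
X^-+ˡ (suc a) k = X^-+ˡ a k

X^-+ : ∀ a b → X^ (a + b) ≈ X^ a ⊛ X^ b
X^-+ a b m with ℕ.≤-<-connex a m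
... | inj₁ a≤m = begin
  X^ (a + b) m              ≡⟨ cong (X^ (a + b)) (ℕ.m+[n∸m]≡n a≤m) ⟨
  X^ (a + b) (a + (m ∸ a))  ≡⟨ X^-+ˡ a (m ∸ a) ⟩
  X^ b (m ∸ a)              ≡⟨ X^-⊛-≥ a (X^ b) m a≤m ⟨
  (X^ a ⊛ X^ b) m           ∎
  where open ≡-Reasoning
... | inj₂ m<a =
  trans (X^-≢ (ℕ.<⇒≢ (ℕ.<-≤-trans m<a (ℕ.m≤m+n a b)))) (sym (X^-⊛-< a (X^ b) m m<a))

X^-cong : ∀ {a b} → a ≡ b → X^ a ≈ X^ b
X^-cong refl = ≈-refl

X^⊛X^ : ∀ {a b c} → a + b ≡ c → X^ a ⊛ X^ b ≈ X^ c
X^⊛X^ {a} {b} a+b≡c = ≈-trans (≈-sym (X^-+ a b)) (X^-cong a+b≡c)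

X^⊛X^⊛X^ : ∀ {a b c n} → a + b + c ≡ n → X^ a ⊛ X^ b ⊛ X^ c ≈ X^ n
X^⊛X^⊛X^ {c = c} a+b+c≡n = ≈-trans (⊛-congʳ (X^ c) (X^⊛X^ refl)) (X^⊛X^ a+b+c≡n)

neg-distribʳ-⊛ : ∀ x y → neg (x ⊛ y) ≈ x ⊛ neg y
neg-distribʳ-⊛ = solve 2 (λ x y → :- (x :* y) := x :* (:- y)) ≈-refl

X^⊛neg-X^ : ∀ {a b c} → a + b ≡ c → X^ a ⊛ neg (X^ b) ≈ neg (X^ c)
X^⊛neg-X^ {a} {b} a+b≡c = ≈-trans (≈-sym (neg-distribʳ-⊛ (X^ a) (X^ b))) (neg-cong (X^⊛X^ a+b≡c))

X^-cancelˡ : ∀ e {f g} → X^ e ⊛ f ≈ X^ e ⊛ g → f ≈ g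
X^-cancelˡ e {f} {g} eq m = begin
  f m                   ≡⟨ shift f ⟨
  (X^ e ⊛ f) (e + m)    ≡⟨ eq (e + m) ⟩
  (X^ e ⊛ g) (e + m)    ≡⟨ shift g ⟩
  g m                   ∎
  where
  open ≡-Reasoning
  shift : ∀ h → (X^ e ⊛ h) (e + m) ≡ h m
  shift h = trans (X^-⊛-≥ e h (e + m) (ℕ.m≤m+n e m)) (cong h (ℕ.m+n∸m≡n e m))

-- Finite sums of power series

sumPS-cong-≤ : ∀ n {F G : ℕ → PS} → (∀ k → k ≤ n → F k ≈ G k) → sumPS n F ≈ sumPS n G
sumPS-cong-≤ n F≈G m = sumℤ-cong-≤ n λ k k≤n → F≈G k k≤n m

sumPS-cong : ∀ n {F G : ℕ → PS} → (∀ k → F k ≈ G k) → sumPS n F ≈ sumPS n G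
sumPS-cong n F≈G = sumPS-cong-≤ n λ k _ → F≈G k

sumPS-distrib-⊕ : ∀ n (F G : ℕ → PS) → sumPS n (λ k → F k ⊕ G k) ≈ sumPS n F ⊕ sumPS n G
sumPS-distrib-⊕ n F G m = sumℤ-distrib-+ n (λ k → F k m) (λ k → G k m)

sumPS-neg : ∀ n (F : ℕ → PS) → sumPS n (λ k → neg (F k)) ≈ neg (sumPS n F)
sumPS-neg n F m = sym (neg-distrib-sumℤ n (λ k → F k m))

⊛-distribˡ-sumPS : ∀ n c (F : ℕ → PS) → c ⊛ sumPS n F ≈ sumPS n (λ k → c ⊛ F k)
⊛-distribˡ-sumPS zero    c F = ≈-refl
⊛-distribˡ-sumPS (suc n) c F =
  ≈-trans (⊛-distribˡ c (sumPS n F) (F (suc n))) (⊕-cong (⊛-distribˡ-sumPS n c F) ≈-refl)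

sumPS-cons : ∀ n (F : ℕ → PS) → sumPS (suc n) F ≈ F 0 ⊕ sumPS n (λ k → F (suc k))
sumPS-cons n F m = sumℤ-cons n (λ k → F k m)

sumPS-reverse : ∀ n (F : ℕ → PS) → sumPS n F ≈ sumPS n (λ k → F (n ∸ k))
sumPS-reverse n F m = sumℤ-reverse n (λ k → F k m)

sumPS-++ : ∀ a b (F : ℕ → PS) → sumPS (a + suc b) F ≈ sumPS a F ⊕ sumPS b (λ i → F (suc (a + i)))
sumPS-++ a zero    F m =
  trans (cong (λ n → sumPS n F m) (ℕ.+-comm a 1))
        (cong (λ j → sumPS a F m ℤ.+ F (suc j) m) (sym (ℕ.+-identityʳ a)))
sumPS-++ a (suc b) F m =
  trans (cong (λ n → sumPS n F m) (ℕ.+-suc a (suc b)))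
        (trans (cong (ℤ._+ F (suc (a + suc b)) m) (sumPS-++ a b F m)) (ℤ.+-assoc (sumPS a F m) _ _))

-- q-Pochhammer symbols and q-binomial coefficients

qfac : ℕ → PS
qfac = poch (X^ 1)

qfac-constant : ∀ n → qfac n 0 ≡ + 1
qfac-constant n = poch-constant (X^ 1) n refl

poch-cong : ∀ {a b} n → a ≈ b → poch a n ≈ poch b n
poch-cong zero    a≈b = ≈-refl
poch-cong (suc n) a≈b = ⊛-cong (poch-cong n a≈b) (⊕-congˡ one (neg-cong (⊛-congʳ (X^ n) a≈b)))

poch-suc : ∀ a n → poch a (suc n) ≈ (one ⊖ a) ⊛ poch (a ⊛ X^ 1) n
poch-suc a zero = begin
  one ⊛ (one ⊖ a ⊛ X^ 0)  ≈⟨ ⊛-congˡ one (⊕-congˡ one (neg-cong (⊛-congˡ a one≈X^0))) ⟨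
  one ⊛ (one ⊖ a ⊛ one)   ≈⟨ solve 1 (λ a → con (+ 1) :* (con (+ 1) :- a :* con (+ 1)) := (con (+ 1) :- a) :* con (+ 1)) ≈-refl a ⟩
  (one ⊖ a) ⊛ one         ∎
  where open ≈-Reasoning
poch-suc a (suc n) = begin
  poch a (suc n) ⊛ (one ⊖ a ⊛ X^ (suc n))
    ≈⟨ ⊛-cong (poch-suc a n) (⊕-congˡ one (neg-cong (⊛-congˡ a (X^-+ 1 n)))) ⟩
  (one ⊖ a) ⊛ poch (a ⊛ X^ 1) n ⊛ (one ⊖ a ⊛ (X^ 1 ⊛ X^ n))
    ≈⟨ regroup a (poch (a ⊛ X^ 1) n) (X^ 1) (X^ n) ⟩
  (one ⊖ a) ⊛ (poch (a ⊛ X^ 1) n ⊛ (one ⊖ a ⊛ X^ 1 ⊛ X^ n)) ∎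
  where
  open ≈-Reasoning
  regroup : ∀ a P x y → (one ⊖ a) ⊛ P ⊛ (one ⊖ a ⊛ (x ⊛ y)) ≈ (one ⊖ a) ⊛ (P ⊛ (one ⊖ a ⊛ x ⊛ y))
  regroup = solve 4 (λ a P x y →
    (con (+ 1) :- a) :* P :* (con (+ 1) :- a :* (x :* y)) := (con (+ 1) :- a) :* (P :* (con (+ 1) :- a :* x :* y)))
    ≈-refl

qfac-suc : ∀ n → qfac (suc n) ≈ (one ⊖ X^ 1) ⊛ poch (X^ 2) n
qfac-suc n = ≈-trans (poch-suc (X^ 1) n) (⊛-congˡ (one ⊖ X^ 1) (poch-cong n (X^⊛X^ refl)))

qfac-suc-suc : ∀ n → qfac (suc (suc n)) ≈ (one ⊖ X^ 1) ⊛ (one ⊖ X^ 2) ⊛ poch (X^ 2 ⊛ X^ 1) n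
qfac-suc-suc n = begin
  qfac (suc (suc n))                                         ≈⟨ qfac-suc (suc n) ⟩
  (one ⊖ X^ 1) ⊛ poch (X^ 2) (suc n)                         ≈⟨ ⊛-congˡ (one ⊖ X^ 1) (poch-suc (X^ 2) n) ⟩
  (one ⊖ X^ 1) ⊛ ((one ⊖ X^ 2) ⊛ poch (X^ 2 ⊛ X^ 1) n)       ≈⟨ ⊛-assoc (one ⊖ X^ 1) (one ⊖ X^ 2) (poch (X^ 2 ⊛ X^ 1) n) ⟨
  (one ⊖ X^ 1) ⊛ (one ⊖ X^ 2) ⊛ poch (X^ 2 ⊛ X^ 1) n         ∎
  where open ≈-Reasoning

qbinom : ℕ → ℕ → PS
qbinom zero    zero    = one
qbinom zero    (suc m) = zeroPS
qbinom (suc M) zero    = one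
qbinom (suc M) (suc m) = qbinom M m ⊕ X^ (suc m) ⊛ qbinom M (suc m)

qbinom-zero : ∀ M → qbinom M 0 ≈ one
qbinom-zero zero    = ≈-refl
qbinom-zero (suc M) = ≈-refl

qbinom-> : ∀ M m → M < m → qbinom M m ≈ zeroPS
qbinom-> zero    (suc m) _         = ≈-refl
qbinom-> (suc M) (suc m) (s≤s M<m) = begin
  qbinom M m ⊕ X^ (suc m) ⊛ qbinom M (suc m)
    ≈⟨ ⊕-cong (qbinom-> M m M<m) (⊛-congˡ (X^ (suc m)) (qbinom-> M (suc m) (ℕ.m<n⇒m<1+n M<m))) ⟩
  zeroPS ⊕ X^ (suc m) ⊛ zeroPS
    ≈⟨ ≈-trans (⊕-identityˡ (X^ (suc m) ⊛ zeroPS)) (⊛-zeroʳ (X^ (suc m))) ⟩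
  zeroPS ∎
  where open ≈-Reasoning

qbinom-diagonal : ∀ M → qbinom M M ≈ one
qbinom-diagonal zero    = ≈-refl
qbinom-diagonal (suc M) = begin
  qbinom M M ⊕ X^ (suc M) ⊛ qbinom M (suc M)
    ≈⟨ ⊕-cong (qbinom-diagonal M) (⊛-congˡ (X^ (suc M)) (qbinom-> M (suc M) ℕ.≤-refl)) ⟩
  one ⊕ X^ (suc M) ⊛ zeroPS
    ≈⟨ ≈-trans (⊕-congˡ one (⊛-zeroʳ (X^ (suc M)))) (⊕-identityʳ one) ⟩
  one ∎
  where open ≈-Reasoning

qfac-qbinom : ∀ a b → qfac a ⊛ qfac b ⊛ qbinom (a + b) a ≈ qfac (a + b)
qfac-qbinom zero b = begin
  one ⊛ qfac b ⊛ qbinom b 0  ≈⟨ ⊛-congˡ (one ⊛ qfac b) (qbinom-zero b) ⟩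
  one ⊛ qfac b ⊛ one         ≈⟨ solve 1 (λ x → con (+ 1) :* x :* con (+ 1) := x) ≈-refl (qfac b) ⟩
  qfac b                     ∎
  where open ≈-Reasoning
qfac-qbinom (suc a) zero rewrite ℕ.+-identityʳ a = begin
  qfac (suc a) ⊛ one ⊛ qbinom (suc a) (suc a)  ≈⟨ ⊛-congˡ (qfac (suc a) ⊛ one) (qbinom-diagonal (suc a)) ⟩
  qfac (suc a) ⊛ one ⊛ one                     ≈⟨ solve 1 (λ x → x :* con (+ 1) :* con (+ 1) := x) ≈-refl (qfac (suc a)) ⟩
  qfac (suc a)                                 ∎
  where open ≈-Reasoning
qfac-qbinom (suc a) (suc b) = begin
  Qa ⊛ fa ⊛ (Qb ⊛ fb) ⊛ (qbinom n a ⊕ X^ (suc a) ⊛ qbinom n (suc a))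
    ≈⟨ distribute Qa Qb fa fb (qbinom n a) (qbinom n (suc a)) (X^ (suc a)) ⟩
  fa ⊛ (Qa ⊛ (Qb ⊛ fb) ⊛ qbinom n a) ⊕ X^ (suc a) ⊛ fb ⊛ (Qa ⊛ fa ⊛ Qb ⊛ qbinom n (suc a))
    ≈⟨ ⊕-cong (⊛-congˡ fa (qfac-qbinom a (suc b))) (⊛-congˡ (X^ (suc a) ⊛ fb) shifted) ⟩
  fa ⊛ qfac n ⊕ X^ (suc a) ⊛ fb ⊛ qfac n
    ≈⟨ ⊕-congˡ (fa ⊛ qfac n) (⊛-congʳ (qfac n) (⊛-congʳ fb (X^-+ 1 a))) ⟩
  fa ⊛ qfac n ⊕ X^ 1 ⊛ X^ a ⊛ fb ⊛ qfac n
    ≈⟨ telescope (qfac n) (X^ 1) (X^ a) (X^ b) ⟩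
  qfac n ⊛ (one ⊖ X^ 1 ⊛ (X^ a ⊛ X^ 1 ⊛ X^ b))
    ≈⟨ ⊛-congˡ (qfac n) (⊕-congˡ one (neg-cong (⊛-congˡ (X^ 1) X^n))) ⟩
  qfac n ⊛ (one ⊖ X^ 1 ⊛ X^ n) ∎
  where
  open ≈-Reasoning
  n = a + suc b
  Qa = qfac a
  Qb = qfac b
  fa = one ⊖ X^ 1 ⊛ X^ a
  fb = one ⊖ X^ 1 ⊛ X^ b
  shifted : Qa ⊛ fa ⊛ Qb ⊛ qbinom n (suc a) ≈ qfac n
  shifted = subst (λ M → qfac (suc a) ⊛ Qb ⊛ qbinom M (suc a) ≈ qfac M) (sym (ℕ.+-suc a b))
                  (qfac-qbinom (suc a) b)
  X^n : X^ a ⊛ X^ 1 ⊛ X^ b ≈ X^ n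
  X^n = ≈-trans (⊛-congʳ (X^ b) (X^⊛X^ (ℕ.+-comm a 1))) (X^⊛X^ (sym (ℕ.+-suc a b)))
  distribute : ∀ Qa Qb fa fb g g′ y →
    Qa ⊛ fa ⊛ (Qb ⊛ fb) ⊛ (g ⊕ y ⊛ g′) ≈ fa ⊛ (Qa ⊛ (Qb ⊛ fb) ⊛ g) ⊕ y ⊛ fb ⊛ (Qa ⊛ fa ⊛ Qb ⊛ g′)
  distribute = solve 7 (λ Qa Qb fa fb g g′ y →
    Qa :* fa :* (Qb :* fb) :* (g :+ y :* g′) := fa :* (Qa :* (Qb :* fb) :* g) :+ y :* fb :* (Qa :* fa :* Qb :* g′))
    ≈-refl
  telescope : ∀ Q x p s → (one ⊖ x ⊛ p) ⊛ Q ⊕ x ⊛ p ⊛ (one ⊖ x ⊛ s) ⊛ Q ≈ Q ⊛ (one ⊖ x ⊛ (p ⊛ x ⊛ s))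
  telescope = solve 4 (λ Q x p s →
    (con (+ 1) :- x :* p) :* Q :+ x :* p :* (con (+ 1) :- x :* s) :* Q := Q :* (con (+ 1) :- x :* (p :* x :* s)))
    ≈-refl

qbinom-sym : ∀ {M} a b → a + b ≡ M → qbinom M a ≈ qbinom M b
qbinom-sym a b refl =
  ⊛-cancelˡ (qfac a ⊛ qfac b) (⊛-constant-one (qfac a) (qfac b) (qfac-constant a) (qfac-constant b)) (begin
    qfac a ⊛ qfac b ⊛ qbinom (a + b) a  ≈⟨ qfac-qbinom a b ⟩
    qfac (a + b)                        ≡⟨ cong qfac (ℕ.+-comm a b) ⟩
    qfac (b + a)                        ≈⟨ qfac-qbinom b a ⟨
    qfac b ⊛ qfac a ⊛ qbinom (b + a) b  ≡⟨ cong (λ M → qfac b ⊛ qfac a ⊛ qbinom M b) (ℕ.+-comm b a) ⟩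
    qfac b ⊛ qfac a ⊛ qbinom (a + b) b  ≈⟨ ⊛-congʳ (qbinom (a + b) b) (⊛-comm (qfac b) (qfac a)) ⟩
    qfac a ⊛ qfac b ⊛ qbinom (a + b) b  ∎)
  where open ≈-Reasoning

qbinom-pascal′ : ∀ {M} m b → m + b ≡ M → qbinom (suc M) (suc m) ≈ X^ b ⊛ qbinom M m ⊕ qbinom M (suc m)
qbinom-pascal′ m zero refl rewrite ℕ.+-identityʳ m = begin
  qbinom (suc m) (suc m)                       ≈⟨ qbinom-diagonal (suc m) ⟩
  one                                          ≈⟨ solve 0 (con (+ 1) := con (+ 1) :* con (+ 1) :+ con (+ 0)) ≈-refl ⟩
  one ⊛ one ⊕ zeroPS                           ≈⟨ ⊕-cong (⊛-cong (≈-sym one≈X^0) (qbinom-diagonal m)) (qbinom-> m (suc m) ℕ.≤-refl) ⟨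
  X^ 0 ⊛ qbinom m m ⊕ qbinom m (suc m)         ∎
  where open ≈-Reasoning
qbinom-pascal′ m (suc b) refl = begin
  qbinom (suc M) (suc m)                       ≈⟨ qbinom-sym (suc m) (suc b) refl ⟩
  qbinom M b ⊕ X^ (suc b) ⊛ qbinom M (suc b)
    ≈⟨ ⊕-cong (qbinom-sym b (suc m) (trans (ℕ.+-comm b (suc m)) (sym (ℕ.+-suc m b))))
              (⊛-congˡ (X^ (suc b)) (qbinom-sym (suc b) m (ℕ.+-comm (suc b) m))) ⟩
  qbinom M (suc m) ⊕ X^ (suc b) ⊛ qbinom M m   ≈⟨ ⊕-comm (qbinom M (suc m)) (X^ (suc b) ⊛ qbinom M m) ⟩
  X^ (suc b) ⊛ qbinom M m ⊕ qbinom M (suc m)   ∎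
  where
  open ≈-Reasoning
  M = m + suc b

-- Bailey pairs relative to q²

qfac-cancels-β : ∀ c n →
  qfac (suc n + suc n) ⊛ (c ⊛ (one ⊕ X^ 1) ⊛ inv (poch (X^ 2) (2 * n)) ⊛ inv (one ⊕ X^ (suc n)))
    ≈ (one ⊖ X^ 2) ⊛ (c ⊛ (one ⊖ X^ (suc n)))
qfac-cancels-β c n = begin
  qfac (suc n + suc n) ⊛ β
    ≡⟨ cong (λ M → qfac M ⊛ β) (index n) ⟩
  qfac (suc t) ⊛ (one ⊖ X^ 1 ⊛ X^ (suc t)) ⊛ β
    ≈⟨ ⊛-congʳ β (⊛-cong (qfac-suc t) (⊕-congˡ one (neg-cong (≈-trans (X^⊛X^ (sym (index n))) (X^-+ (suc n) (suc n)))))) ⟩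
  (one ⊖ X^ 1) ⊛ P ⊛ (one ⊖ y ⊛ y) ⊛ β
    ≈⟨ regroup (X^ 1) P y c (inv P) (inv (one ⊕ y)) ⟩
  (one ⊖ X^ 1 ⊛ X^ 1) ⊛ (c ⊛ (one ⊖ y)) ⊛ (P ⊛ inv P ⊛ ((one ⊕ y) ⊛ inv (one ⊕ y)))
    ≈⟨ ⊛-cong (⊛-congʳ (c ⊛ (one ⊖ y)) (⊕-congˡ one (neg-cong (X^⊛X^ refl))))
              (⊛-cong (⊛-inverseʳ P (poch-constant (X^ 2) t refl)) (⊛-inverseʳ (one ⊕ y) refl)) ⟩
  (one ⊖ X^ 2) ⊛ (c ⊛ (one ⊖ y)) ⊛ (one ⊛ one)
    ≈⟨ solve 1 (λ x → x :* (con (+ 1) :* con (+ 1)) := x) ≈-refl _ ⟩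
  (one ⊖ X^ 2) ⊛ (c ⊛ (one ⊖ y)) ∎
  where
  open ≈-Reasoning
  t = 2 * n
  y = X^ (suc n)
  P = poch (X^ 2) t
  β = c ⊛ (one ⊕ X^ 1) ⊛ inv P ⊛ inv (one ⊕ y)
  index : ∀ n → suc n + suc n ≡ suc (suc (2 * n))
  index = solve-∀
  regroup : ∀ x P y c iP iy →
    (one ⊖ x) ⊛ P ⊛ (one ⊖ y ⊛ y) ⊛ (c ⊛ (one ⊕ x) ⊛ iP ⊛ iy)
      ≈ (one ⊖ x ⊛ x) ⊛ (c ⊛ (one ⊖ y)) ⊛ (P ⊛ iP ⊛ ((one ⊕ y) ⊛ iy))
  regroup = solve 6 (λ x P y c iP iy →
    (con (+ 1) :- x) :* P :* (con (+ 1) :- y :* y) :* (c :* (con (+ 1) :+ x) :* iP :* iy)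
      := (con (+ 1) :- x :* x) :* (c :* (con (+ 1) :- y)) :* (P :* iP :* ((con (+ 1) :+ y) :* iy)))
    ≈-refl

qfac-cancels-term : ∀ {n k} → k ≤ n → ∀ a →
  qfac (suc n + suc n) ⊛ (a ⊛ inv (qfac (n ∸ k)) ⊛ inv (poch (X^ 2 ⊛ X^ 1) (n + k)))
    ≈ (one ⊖ X^ 1) ⊛ (one ⊖ X^ 2) ⊛ (a ⊛ qbinom (suc n + suc n) (n ∸ k))
qfac-cancels-term {n} {k} k≤n a = begin
  qfac N ⊛ (a ⊛ inv Q ⊛ inv P)
    ≡⟨ cong (λ M → qfac M ⊛ (a ⊛ inv Q ⊛ inv P)) index ⟨
  qfac (j + suc (suc b)) ⊛ (a ⊛ inv Q ⊛ inv P)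
    ≈⟨ ⊛-congʳ (a ⊛ inv Q ⊛ inv P) (qfac-qbinom j (suc (suc b))) ⟨
  Q ⊛ qfac (suc (suc b)) ⊛ qbinom (j + suc (suc b)) j ⊛ (a ⊛ inv Q ⊛ inv P)
    ≡⟨ cong (λ M → Q ⊛ qfac (suc (suc b)) ⊛ qbinom M j ⊛ (a ⊛ inv Q ⊛ inv P)) index ⟩
  Q ⊛ qfac (suc (suc b)) ⊛ qbinom N j ⊛ (a ⊛ inv Q ⊛ inv P)
    ≈⟨ ⊛-congʳ (a ⊛ inv Q ⊛ inv P) (⊛-congʳ (qbinom N j) (⊛-congˡ Q (qfac-suc-suc b))) ⟩
  Q ⊛ (L ⊛ P) ⊛ qbinom N j ⊛ (a ⊛ inv Q ⊛ inv P)
    ≈⟨ regroup Q L P (qbinom N j) a (inv Q) (inv P) ⟩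
  L ⊛ (a ⊛ qbinom N j) ⊛ (Q ⊛ inv Q ⊛ (P ⊛ inv P))
    ≈⟨ ⊛-congˡ (L ⊛ (a ⊛ qbinom N j))
         (⊛-cong (⊛-inverseʳ Q (qfac-constant j)) (⊛-inverseʳ P (poch-constant (X^ 2 ⊛ X^ 1) b refl))) ⟩
  L ⊛ (a ⊛ qbinom N j) ⊛ (one ⊛ one)
    ≈⟨ solve 1 (λ x → x :* (con (+ 1) :* con (+ 1)) := x) ≈-refl (L ⊛ (a ⊛ qbinom N j)) ⟩
  L ⊛ (a ⊛ qbinom N j) ∎
  where
  open ≈-Reasoning
  N = suc n + suc n
  j = n ∸ k
  b = n + k
  L = (one ⊖ X^ 1) ⊛ (one ⊖ X^ 2)
  Q = qfac j
  P = poch (X^ 2 ⊛ X^ 1) b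
  index : j + suc (suc b) ≡ N
  index = subst (λ x → j + suc (suc (x + k)) ≡ suc x + suc x) (ℕ.m∸n+n≡m k≤n) (arith j k)
    where
    arith : ∀ j k → j + suc (suc (j + k + k)) ≡ suc (j + k) + suc (j + k)
    arith = solve-∀
  regroup : ∀ Q L P G a iQ iP → Q ⊛ (L ⊛ P) ⊛ G ⊛ (a ⊛ iQ ⊛ iP) ≈ L ⊛ (a ⊛ G) ⊛ (Q ⊛ iQ ⊛ (P ⊛ iP))
  regroup = solve 7 (λ Q L P G a iQ iP →
    Q :* (L :* P) :* G :* (a :* iQ :* iP) := L :* (a :* G) :* (Q :* iQ :* (P :* iP)))
    ≈-refl

bailey-q²-criterion : ∀ α β →
  (∀ n → qfac (suc n + suc n) ⊛ β n
           ≈ (one ⊖ X^ 1) ⊛ (one ⊖ X^ 2) ⊛ sumPS n (λ k → α k ⊛ qbinom (suc n + suc n) (n ∸ k))) →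
  BaileyPair (X^ 2) α β
bailey-q²-criterion α β hyp n = ⊛-cancelˡ (qfac N) (qfac-constant N) (begin
  qfac N ⊛ β n                                    ≈⟨ hyp n ⟩
  L ⊛ sumPS n (λ k → α k ⊛ qbinom N (n ∸ k))      ≈⟨ ⊛-distribˡ-sumPS n L (λ k → α k ⊛ qbinom N (n ∸ k)) ⟩
  sumPS n (λ k → L ⊛ (α k ⊛ qbinom N (n ∸ k)))    ≈⟨ sumPS-cong-≤ n (λ k k≤n → qfac-cancels-term k≤n (α k)) ⟨
  sumPS n (λ k → qfac N ⊛ term k)                 ≈⟨ ⊛-distribˡ-sumPS n (qfac N) term ⟨
  qfac N ⊛ sumPS n term                           ∎)
  where
  open ≈-Reasoning
  N = suc n + suc n
  L = (one ⊖ X^ 1) ⊛ (one ⊖ X^ 2)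
  term : ℕ → PS
  term k = α k ⊛ inv (poch (X^ 1) (n ∸ k)) ⊛ inv (poch (X^ 2 ⊛ X^ 1) (n + k))

fac-cancels : ∀ k d g → (one ⊖ X^ 1) ⊛ (fac k ⊛ d ⊛ g) ≈ (one ⊖ X^ (suc k)) ⊛ d ⊛ g
fac-cancels k d g = begin
  (one ⊖ X^ 1) ⊛ ((one ⊖ X^ (suc k)) ⊛ inv (one ⊖ X^ 1) ⊛ d ⊛ g)
    ≈⟨ regroup (one ⊖ X^ 1) (inv (one ⊖ X^ 1)) (one ⊖ X^ (suc k)) d g ⟩
  (one ⊖ X^ 1) ⊛ inv (one ⊖ X^ 1) ⊛ ((one ⊖ X^ (suc k)) ⊛ d ⊛ g)
    ≈⟨ ⊛-congʳ ((one ⊖ X^ (suc k)) ⊛ d ⊛ g) (⊛-inverseʳ (one ⊖ X^ 1) refl) ⟩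
  one ⊛ ((one ⊖ X^ (suc k)) ⊛ d ⊛ g)
    ≈⟨ ⊛-identityˡ _ ⟩
  (one ⊖ X^ (suc k)) ⊛ d ⊛ g ∎
  where
  open ≈-Reasoning
  regroup : ∀ u iu v d g → u ⊛ (v ⊛ iu ⊛ d ⊛ g) ≈ u ⊛ iu ⊛ (v ⊛ d ⊛ g)
  regroup = solve 5 (λ u iu v d g → u :* (v :* iu :* d :* g) := u :* iu :* (v :* d :* g)) ≈-refl

bailey-pair-of-identity : ∀ {α β} (D c : ℕ → PS) →
  (∀ k → α k ≈ fac k ⊛ D k) →
  (∀ n → β n ≈ c n ⊛ (one ⊕ X^ 1) ⊛ inv (poch (X^ 2) (2 * n)) ⊛ inv (one ⊕ X^ (suc n))) →
  (∀ n → sumPS n (λ k → (one ⊖ X^ (suc k)) ⊛ D k ⊛ qbinom (suc n + suc n) (n ∸ k)) ≈ c n ⊛ (one ⊖ X^ (suc n))) →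
  BaileyPair (X^ 2) α β
bailey-pair-of-identity {α} {β} D c α≈ β≈ sum≈ = bailey-q²-criterion α β λ n →
  let N = suc n + suc n
      G = qbinom N
      open ≈-Reasoning
  in begin
  qfac N ⊛ β n
    ≈⟨ ⊛-congˡ (qfac N) (β≈ n) ⟩
  qfac N ⊛ (c n ⊛ (one ⊕ X^ 1) ⊛ inv (poch (X^ 2) (2 * n)) ⊛ inv (one ⊕ X^ (suc n)))
    ≈⟨ qfac-cancels-β (c n) n ⟩
  (one ⊖ X^ 2) ⊛ (c n ⊛ (one ⊖ X^ (suc n)))
    ≈⟨ ⊛-congˡ (one ⊖ X^ 2) (sum≈ n) ⟨
  (one ⊖ X^ 2) ⊛ sumPS n (λ k → (one ⊖ X^ (suc k)) ⊛ D k ⊛ G (n ∸ k))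
    ≈⟨ ⊛-congˡ (one ⊖ X^ 2) (sumPS-cong n λ k → ≈-trans (⊛-congˡ (one ⊖ X^ 1) (⊛-congʳ (G (n ∸ k)) (α≈ k)))
                                                          (fac-cancels k (D k) (G (n ∸ k)))) ⟨
  (one ⊖ X^ 2) ⊛ sumPS n (λ k → (one ⊖ X^ 1) ⊛ (α k ⊛ G (n ∸ k)))
    ≈⟨ ⊛-congˡ (one ⊖ X^ 2) (⊛-distribˡ-sumPS n (one ⊖ X^ 1) (λ k → α k ⊛ G (n ∸ k))) ⟨
  (one ⊖ X^ 2) ⊛ ((one ⊖ X^ 1) ⊛ sumPS n (λ k → α k ⊛ G (n ∸ k)))
    ≈⟨ solve 3 (λ u v s → u :* (v :* s) := v :* u :* s) ≈-refl (one ⊖ X^ 2) (one ⊖ X^ 1) (sumPS n (λ k → α k ⊛ G (n ∸ k))) ⟩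
  (one ⊖ X^ 1) ⊛ (one ⊖ X^ 2) ⊛ sumPS n (λ k → α k ⊛ G (n ∸ k)) ∎

module QuasiPeriodicSums (f⁺ f⁻ : ℕ → PS) where

  -- f[ c - m ] is f (c - m) for the two-sided sequence f with f j = f⁺ j and f (- j) = f⁻ j.
  f[_-_] : ℕ → ℕ → PS
  f[ c     - zero  ] = f⁺ c
  f[ zero  - suc m ] = f⁻ (suc m)
  f[ suc c - suc m ] = f[ c - m ]

  f[r+c-r] : ∀ r c → f[ r + c - r ] ≡ f⁺ c
  f[r+c-r] zero    c = refl
  f[r+c-r] (suc r) c = f[r+c-r] r c

  f[r-r+1+c] : ∀ r c → f[ r - r + suc c ] ≡ f⁻ (suc c)
  f[r-r+1+c] zero    c = refl
  f[r-r+1+c] (suc r) c = f[r-r+1+c] r c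

  θ : ℕ → ℕ → ℕ → ℕ → PS
  θ a M c m = f[ c - m ] ⊛ X^ (a * m) ⊛ qbinom M m

  Θ : ℕ → ℕ → ℕ → PS
  Θ a M c = sumPS M (θ a M c)

  θ-at-0 : ∀ a M c → θ a M c 0 ≈ f⁺ c
  θ-at-0 a M c = begin
    f⁺ c ⊛ X^ (a * 0) ⊛ qbinom M 0  ≈⟨ ⊛-cong (⊛-congˡ (f⁺ c) (X^-cong (ℕ.*-zeroʳ a))) (qbinom-zero M) ⟩
    f⁺ c ⊛ X^ 0 ⊛ one               ≈⟨ ⊛-congʳ one (⊛-congˡ (f⁺ c) one≈X^0) ⟨
    f⁺ c ⊛ one ⊛ one                ≈⟨ solve 1 (λ x → x :* con (+ 1) :* con (+ 1) := x) ≈-refl (f⁺ c) ⟩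
    f⁺ c                            ∎
    where open ≈-Reasoning

  Θ-zero : ∀ a c → Θ a 0 c ≈ f⁺ c
  Θ-zero a = θ-at-0 a 0

  Θ-cons : ∀ a M c → Θ a M c ≈ f⁺ c ⊕ sumPS M (λ k → θ a M c (suc k))
  Θ-cons a M c = begin
    sumPS M (θ a M c)                                         ≈⟨ ⊕-identityʳ _ ⟨
    sumPS M (θ a M c) ⊕ zeroPS                                ≈⟨ ⊕-congˡ (sumPS M (θ a M c)) last ⟨
    sumPS (suc M) (θ a M c)                                   ≈⟨ sumPS-cons M (θ a M c) ⟩
    θ a M c 0 ⊕ sumPS M (λ k → θ a M c (suc k))               ≈⟨ ⊕-congʳ _ (θ-at-0 a M c) ⟩
    f⁺ c ⊕ sumPS M (λ k → θ a M c (suc k))                    ∎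
    where
    open ≈-Reasoning
    last : θ a M c (suc M) ≈ zeroPS
    last = ≈-trans (⊛-congˡ (f[ c - suc M ] ⊛ X^ (a * suc M)) (qbinom-> M (suc M) ℕ.≤-refl))
                   (⊛-zeroʳ (f[ c - suc M ] ⊛ X^ (a * suc M)))

  Θ-step : ∀ a b b′ E M c →
    (∀ k → k ≤ M → θ b (suc M) (suc c) (suc k) ≈ X^ E ⊛ θ a M c k ⊕ θ b′ M (suc c) (suc k)) →
    Θ b (suc M) (suc c) ≈ X^ E ⊛ Θ a M c ⊕ Θ b′ M (suc c)
  Θ-step a b b′ E M c split = begin
    sumPS (suc M) (θ b (suc M) (suc c))
      ≈⟨ sumPS-cons M (θ b (suc M) (suc c)) ⟩
    θ b (suc M) (suc c) 0 ⊕ sumPS M (λ k → θ b (suc M) (suc c) (suc k))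
      ≈⟨ ⊕-cong (θ-at-0 b (suc M) (suc c)) (sumPS-cong-≤ M split) ⟩
    f⁺ (suc c) ⊕ sumPS M (λ k → X^ E ⊛ θ a M c k ⊕ θ′ (suc k))
      ≈⟨ ⊕-congˡ (f⁺ (suc c)) (sumPS-distrib-⊕ M (λ k → X^ E ⊛ θ a M c k) (λ k → θ′ (suc k))) ⟩
    f⁺ (suc c) ⊕ (sumPS M (λ k → X^ E ⊛ θ a M c k) ⊕ rest)
      ≈⟨ ⊕-congˡ (f⁺ (suc c)) (⊕-congʳ rest (⊛-distribˡ-sumPS M (X^ E) (θ a M c))) ⟨
    f⁺ (suc c) ⊕ (X^ E ⊛ Θ a M c ⊕ rest)
      ≈⟨ solve 3 (λ x y z → x :+ (y :+ z) := y :+ (x :+ z)) ≈-refl (f⁺ (suc c)) (X^ E ⊛ Θ a M c) rest ⟩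
    X^ E ⊛ Θ a M c ⊕ (f⁺ (suc c) ⊕ rest)
      ≈⟨ ⊕-congˡ (X^ E ⊛ Θ a M c) (Θ-cons b′ M (suc c)) ⟨
    X^ E ⊛ Θ a M c ⊕ Θ b′ M (suc c) ∎
    where
    open ≈-Reasoning
    θ′ = θ b′ M (suc c)
    rest = sumPS M (λ k → θ′ (suc k))

  Θ-pascal : ∀ a M c → Θ a (suc M) (suc c) ≈ X^ a ⊛ Θ a M c ⊕ Θ (suc a) M (suc c)
  Θ-pascal a M c = Θ-step a a (suc a) a M c λ k _ → begin
    f[ c - k ] ⊛ X^ (a * suc k) ⊛ (qbinom M k ⊕ X^ (suc k) ⊛ qbinom M (suc k))
      ≈⟨ ⊛-congʳ (qbinom M k ⊕ X^ (suc k) ⊛ qbinom M (suc k)) (⊛-congˡ f[ c - k ] (X^⊛X^ (sym (ℕ.*-suc a k)))) ⟨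
    f[ c - k ] ⊛ (X^ a ⊛ X^ (a * k)) ⊛ (qbinom M k ⊕ X^ (suc k) ⊛ qbinom M (suc k))
      ≈⟨ distribute f[ c - k ] (X^ a) (X^ (a * k)) (X^ (suc k)) (qbinom M k) (qbinom M (suc k)) ⟩
    X^ a ⊛ θ a M c k ⊕ f[ c - k ] ⊛ (X^ a ⊛ X^ (a * k) ⊛ X^ (suc k)) ⊛ qbinom M (suc k)
      ≈⟨ ⊕-congˡ (X^ a ⊛ θ a M c k) (⊛-congʳ (qbinom M (suc k)) (⊛-congˡ f[ c - k ] (X^⊛X^⊛X^ (exponent a k)))) ⟩
    X^ a ⊛ θ a M c k ⊕ θ (suc a) M (suc c) (suc k) ∎
    where
    open ≈-Reasoning
    exponent : ∀ a k → a + a * k + suc k ≡ suc a * suc k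
    exponent = solve-∀
    distribute : ∀ f x y z g g′ → f ⊛ (x ⊛ y) ⊛ (g ⊕ z ⊛ g′) ≈ x ⊛ (f ⊛ y ⊛ g) ⊕ f ⊛ (x ⊛ y ⊛ z) ⊛ g′
    distribute = solve 6 (λ f x y z g g′ →
      f :* (x :* y) :* (g :+ z :* g′) := x :* (f :* y :* g) :+ f :* (x :* y :* z) :* g′) ≈-refl

  Θ-pascal′ : ∀ a M c → Θ (suc a) (suc M) (suc c) ≈ X^ (suc a + M) ⊛ Θ a M c ⊕ Θ (suc a) M (suc c)
  Θ-pascal′ a M c = Θ-step a (suc a) (suc a) (suc a + M) M c λ k k≤M → begin
    f[ c - k ] ⊛ X^ (suc a * suc k) ⊛ qbinom (suc M) (suc k)
      ≈⟨ ⊛-congˡ (f[ c - k ] ⊛ X^ (suc a * suc k)) (qbinom-pascal′ k (M ∸ k) (ℕ.m+[n∸m]≡n k≤M)) ⟩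
    f[ c - k ] ⊛ X^ (suc a * suc k) ⊛ (X^ (M ∸ k) ⊛ qbinom M k ⊕ qbinom M (suc k))
      ≈⟨ distribute f[ c - k ] (X^ (suc a * suc k)) (X^ (M ∸ k)) (qbinom M k) (qbinom M (suc k)) ⟩
    X^ (suc a * suc k) ⊛ X^ (M ∸ k) ⊛ (f[ c - k ] ⊛ qbinom M k) ⊕ θ (suc a) M (suc c) (suc k)
      ≈⟨ ⊕-congʳ (θ (suc a) M (suc c) (suc k))
           (⊛-congʳ (f[ c - k ] ⊛ qbinom M k) (≈-trans (X^⊛X^ (exponent k≤M)) (X^-+ (suc a + M) (a * k)))) ⟩
    X^ (suc a + M) ⊛ X^ (a * k) ⊛ (f[ c - k ] ⊛ qbinom M k) ⊕ θ (suc a) M (suc c) (suc k)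
      ≈⟨ ⊕-congʳ (θ (suc a) M (suc c) (suc k)) (regroup (X^ (suc a + M)) (X^ (a * k)) f[ c - k ] (qbinom M k)) ⟩
    X^ (suc a + M) ⊛ θ a M c k ⊕ θ (suc a) M (suc c) (suc k) ∎
    where
    open ≈-Reasoning
    exponent : ∀ {k} → k ≤ M → suc a * suc k + (M ∸ k) ≡ suc a + M + a * k
    exponent {k} k≤M = trans (arith a k (M ∸ k)) (cong (λ x → suc a + x + a * k) (ℕ.m+[n∸m]≡n k≤M))
      where
      arith : ∀ a k d → suc a * suc k + d ≡ suc a + (k + d) + a * k
      arith = solve-∀
    distribute : ∀ f y z g g′ → f ⊛ y ⊛ (z ⊛ g ⊕ g′) ≈ y ⊛ z ⊛ (f ⊛ g) ⊕ f ⊛ y ⊛ g′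
    distribute = solve 5 (λ f y z g g′ → f :* y :* (z :* g :+ g′) := y :* z :* (f :* g) :+ f :* y :* g′) ≈-refl
    regroup : ∀ x y f g → x ⊛ y ⊛ (f ⊛ g) ≈ x ⊛ (f ⊛ y ⊛ g)
    regroup = solve 4 (λ x y f g → x :* y :* (f :* g) := x :* (f :* y :* g)) ≈-refl

  -- The hypotheses say f (j + 3) = q^(L j + K) f j for all j ∈ ℤ, where L = ℓ + 1, multiplied
  -- through to avoid negative powers of q; f-shift₁, f-shift₂, f-shift₃ are the cases j = -1, -2, -3.
  module QuasiPeriodicity (ℓ K : ℕ)
    (f⁺-shift : ∀ k → f⁺ (3 + k) ≈ X^ (suc ℓ * k + K) ⊛ f⁺ k)
    (f⁻-shift : ∀ k → X^ K ⊛ f⁻ (3 + k) ≈ X^ (suc ℓ * (3 + k)) ⊛ f⁻ k)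
    (f-shift₁ : X^ (suc ℓ) ⊛ f⁺ 2 ≈ X^ K ⊛ f⁻ 1)
    (f-shift₂ : X^ (suc ℓ * 2) ⊛ f⁺ 1 ≈ X^ K ⊛ f⁻ 2)
    (f-shift₃ : X^ (suc ℓ * 3) ⊛ f⁺ 0 ≈ X^ K ⊛ f⁻ 3)
    where

    L : ℕ
    L = suc ℓ

    K≡L*0+K : K ≡ L * 0 + K
    K≡L*0+K = cong (_+ K) (sym (ℕ.*-zeroʳ L))

    f-shift : ∀ c m → X^ (L * m) ⊛ f[ 3 + c - m ] ≈ X^ (L * c + K) ⊛ f[ c - m ]
    f-shift c zero = begin
      X^ (L * 0) ⊛ f⁺ (3 + c)      ≈⟨ ⊛-congʳ (f⁺ (3 + c)) (X^-cong (ℕ.*-zeroʳ L)) ⟩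
      X^ 0 ⊛ f⁺ (3 + c)            ≈⟨ ⊛-congʳ (f⁺ (3 + c)) one≈X^0 ⟨
      one ⊛ f⁺ (3 + c)             ≈⟨ ⊛-identityˡ (f⁺ (3 + c)) ⟩
      f⁺ (3 + c)                   ≈⟨ f⁺-shift c ⟩
      X^ (L * c + K) ⊛ f⁺ c        ∎
      where open ≈-Reasoning
    f-shift (suc c) (suc m) = begin
      X^ (L * suc m) ⊛ f[ 3 + c - m ]           ≈⟨ ⊛-congʳ f[ 3 + c - m ] (X^⊛X^ (sym (ℕ.*-suc L m))) ⟨
      X^ L ⊛ X^ (L * m) ⊛ f[ 3 + c - m ]        ≈⟨ ⊛-assoc (X^ L) (X^ (L * m)) f[ 3 + c - m ] ⟩
      X^ L ⊛ (X^ (L * m) ⊛ f[ 3 + c - m ])      ≈⟨ ⊛-congˡ (X^ L) (f-shift c m) ⟩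
      X^ L ⊛ (X^ (L * c + K) ⊛ f[ c - m ])      ≈⟨ ⊛-assoc (X^ L) (X^ (L * c + K)) f[ c - m ] ⟨
      X^ L ⊛ X^ (L * c + K) ⊛ f[ c - m ]        ≈⟨ ⊛-congʳ f[ c - m ] (X^⊛X^ (exponent c)) ⟩
      X^ (L * suc c + K) ⊛ f[ c - m ]           ∎
      where
      open ≈-Reasoning
      exponent : ∀ c → L + (L * c + K) ≡ L * suc c + K
      exponent c = trans (sym (ℕ.+-assoc L (L * c) K)) (cong (_+ K) (sym (ℕ.*-suc L c)))
    f-shift zero 1 =
      ≈-trans (⊛-congʳ (f⁺ 2) (X^-cong (ℕ.*-identityʳ L))) (≈-trans f-shift₁ (⊛-congʳ (f⁻ 1) (X^-cong K≡L*0+K)))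
    f-shift zero 2 = ≈-trans f-shift₂ (⊛-congʳ (f⁻ 2) (X^-cong K≡L*0+K))
    f-shift zero 3 = ≈-trans f-shift₃ (⊛-congʳ (f⁻ 3) (X^-cong K≡L*0+K))
    f-shift zero (suc (suc (suc (suc m)))) =
      ≈-sym (≈-trans (⊛-congʳ (f⁻ (4 + m)) (X^-cong (sym K≡L*0+K))) (f⁻-shift (suc m)))

    Θ-shift : ∀ a M c → Θ (L + a) M (3 + c) ≈ X^ (L * c + K) ⊛ Θ a M c
    Θ-shift a M c = begin
      sumPS M (θ (L + a) M (3 + c))                  ≈⟨ sumPS-cong M shift-term ⟩
      sumPS M (λ m → X^ (L * c + K) ⊛ θ a M c m)     ≈⟨ ⊛-distribˡ-sumPS M (X^ (L * c + K)) (θ a M c) ⟨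
      X^ (L * c + K) ⊛ Θ a M c                       ∎
      where
      open ≈-Reasoning
      shift-term : ∀ m → θ (L + a) M (3 + c) m ≈ X^ (L * c + K) ⊛ θ a M c m
      shift-term m = begin
        f[ 3 + c - m ] ⊛ X^ ((L + a) * m) ⊛ qbinom M m
          ≈⟨ ⊛-congʳ (qbinom M m) (⊛-congˡ f[ 3 + c - m ] (X^⊛X^ (sym (ℕ.*-distribʳ-+ m L a)))) ⟨
        f[ 3 + c - m ] ⊛ (X^ (L * m) ⊛ X^ (a * m)) ⊛ qbinom M m
          ≈⟨ regroup f[ 3 + c - m ] (X^ (L * m)) (X^ (a * m)) (qbinom M m) ⟩
        X^ (L * m) ⊛ f[ 3 + c - m ] ⊛ (X^ (a * m) ⊛ qbinom M m)
          ≈⟨ ⊛-congʳ (X^ (a * m) ⊛ qbinom M m) (f-shift c m) ⟩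
        X^ (L * c + K) ⊛ f[ c - m ] ⊛ (X^ (a * m) ⊛ qbinom M m)
          ≈⟨ regroup′ (X^ (L * c + K)) f[ c - m ] (X^ (a * m)) (qbinom M m) ⟩
        X^ (L * c + K) ⊛ θ a M c m ∎
        where
        regroup : ∀ f x y g → f ⊛ (x ⊛ y) ⊛ g ≈ x ⊛ f ⊛ (y ⊛ g)
        regroup = solve 4 (λ f x y g → f :* (x :* y) :* g := x :* f :* (y :* g)) ≈-refl
        regroup′ : ∀ x f y g → x ⊛ f ⊛ (y ⊛ g) ≈ x ⊛ (f ⊛ y ⊛ g)
        regroup′ = solve 4 (λ x f y g → x :* f :* (y :* g) := x :* (f :* y :* g)) ≈-refl

    -- By H-scaled, H N m = q^(L N + K) (1 - q^(N - m)) f (N - m) [N + N, m].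
    H : ℕ → ℕ → PS
    H N m = X^ (L * N + K) ⊛ θ 0 (N + N) N m ⊖ X^ N ⊛ θ ℓ (N + N) (3 + N) m

    H-scaled : ∀ N m → X^ m ⊛ H N m ≈ X^ (L * N + K) ⊛ ((X^ m ⊖ X^ N) ⊛ f[ N - m ] ⊛ qbinom (N + N) m)
    H-scaled N m = begin
      X^ m ⊛ (C ⊛ (f ⊛ X^ 0 ⊛ G) ⊖ X^ N ⊛ (f₃ ⊛ X^ (ℓ * m) ⊛ G))
        ≈⟨ expand (X^ m) C f (X^ 0) G (X^ N) f₃ (X^ (ℓ * m)) ⟩
      X^ m ⊛ C ⊛ (f ⊛ X^ 0 ⊛ G) ⊖ X^ N ⊛ (X^ m ⊛ X^ (ℓ * m) ⊛ f₃ ⊛ G)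
        ≈⟨ ⊕-cong (⊛-congˡ (X^ m ⊛ C) (⊛-congʳ G (⊛-congˡ f (≈-sym one≈X^0))))
                  (neg-cong (⊛-congˡ (X^ N) (⊛-congʳ G (≈-trans (⊛-congʳ f₃ (X^⊛X^ refl)) (f-shift N m))))) ⟩
      X^ m ⊛ C ⊛ (f ⊛ one ⊛ G) ⊖ X^ N ⊛ (C ⊛ f ⊛ G)
        ≈⟨ collect (X^ m) C f G (X^ N) ⟩
      C ⊛ ((X^ m ⊖ X^ N) ⊛ f ⊛ G) ∎
      where
      open ≈-Reasoning
      C = X^ (L * N + K)
      f = f[ N - m ]
      f₃ = f[ 3 + N - m ]
      G = qbinom (N + N) m
      expand : ∀ x c f x₀ g y f₃ z → x ⊛ (c ⊛ (f ⊛ x₀ ⊛ g) ⊖ y ⊛ (f₃ ⊛ z ⊛ g))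
                                      ≈ x ⊛ c ⊛ (f ⊛ x₀ ⊛ g) ⊖ y ⊛ (x ⊛ z ⊛ f₃ ⊛ g)
      expand = solve 8 (λ x c f x₀ g y f₃ z → x :* (c :* (f :* x₀ :* g) :- y :* (f₃ :* z :* g))
                                               := x :* c :* (f :* x₀ :* g) :- y :* (x :* z :* f₃ :* g)) ≈-refl
      collect : ∀ x c f g y → x ⊛ c ⊛ (f ⊛ one ⊛ g) ⊖ y ⊛ (c ⊛ f ⊛ g) ≈ c ⊛ ((x ⊖ y) ⊛ f ⊛ g)
      collect = solve 5 (λ x c f g y → x :* c :* (f :* con (+ 1) :* g) :- y :* (c :* f :* g)
                                       := c :* ((x :- y) :* f :* g)) ≈-refl

    H-middle : ∀ N → H N N ≈ zeroPS
    H-middle N = X^-cancelˡ N (begin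
      X^ N ⊛ H N N                                                              ≈⟨ H-scaled N N ⟩
      X^ (L * N + K) ⊛ ((X^ N ⊖ X^ N) ⊛ f[ N - N ] ⊛ qbinom (N + N) N)          ≈⟨ vanish (X^ (L * N + K)) (X^ N) f[ N - N ] (qbinom (N + N) N) ⟩
      zeroPS                                                                    ≈⟨ ⊛-zeroʳ (X^ N) ⟨
      X^ N ⊛ zeroPS                                                             ∎)
      where
      open ≈-Reasoning
      vanish : ∀ c x f g → c ⊛ ((x ⊖ x) ⊛ f ⊛ g) ≈ zeroPS
      vanish = solve 4 (λ c x f g → c :* ((x :- x) :* f :* g) := con (+ 0)) ≈-refl

    H-below : ∀ {N} r k → r + suc k ≡ N →
      H N r ≈ X^ (L * N + K) ⊛ ((one ⊖ X^ (suc k)) ⊛ f⁺ (suc k) ⊛ qbinom (N + N) r)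
    H-below {N} r k refl = X^-cancelˡ r (begin
      X^ r ⊛ H N r                                      ≈⟨ H-scaled N r ⟩
      C ⊛ ((X^ r ⊖ X^ N) ⊛ f[ N - r ] ⊛ G)
        ≈⟨ ⊛-congˡ C (⊛-congʳ G (⊛-cong (⊕-congˡ (X^ r) (neg-cong (X^-+ r (suc k)))) (≈-reflexive (f[r+c-r] r (suc k))))) ⟩
      C ⊛ ((X^ r ⊖ X^ r ⊛ p) ⊛ f⁺ (suc k) ⊛ G)          ≈⟨ factor C (X^ r) p (f⁺ (suc k)) G ⟩
      X^ r ⊛ (C ⊛ ((one ⊖ p) ⊛ f⁺ (suc k) ⊛ G))         ∎)
      where
      open ≈-Reasoning
      C = X^ (L * N + K)
      p = X^ (suc k)
      G = qbinom (N + N) r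
      factor : ∀ c s p f g → c ⊛ ((s ⊖ s ⊛ p) ⊛ f ⊛ g) ≈ s ⊛ (c ⊛ ((one ⊖ p) ⊛ f ⊛ g))
      factor = solve 5 (λ c s p f g → c :* ((s :- s :* p) :* f :* g) := s :* (c :* ((con (+ 1) :- p) :* f :* g))) ≈-refl

    H-above : ∀ {N} r k → r + suc k ≡ N →
      X^ (suc k) ⊛ H N (N + suc k) ≈ X^ (L * N + K) ⊛ ((X^ (suc k) ⊖ one) ⊛ f⁻ (suc k) ⊛ qbinom (N + N) r)
    H-above {N} r k refl = X^-cancelˡ N (begin
      X^ N ⊛ (p ⊛ H N m₂)                                ≈⟨ ⊛-assoc (X^ N) p (H N m₂) ⟨
      X^ N ⊛ p ⊛ H N m₂                                  ≈⟨ ⊛-congʳ (H N m₂) (X^-+ N (suc k)) ⟨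
      X^ m₂ ⊛ H N m₂                                     ≈⟨ H-scaled N m₂ ⟩
      C ⊛ ((X^ m₂ ⊖ X^ N) ⊛ f[ N - m₂ ] ⊛ qbinom (N + N) m₂)
        ≈⟨ ⊛-congˡ C (⊛-cong (⊛-cong (⊕-congʳ (neg (X^ N)) (X^-+ N (suc k))) (≈-reflexive (f[r-r+1+c] N k)))
                             (qbinom-sym m₂ r (trans (ℕ.+-assoc N (suc k) r) (cong (λ x → N + x) (ℕ.+-comm (suc k) r))))) ⟩
      C ⊛ ((X^ N ⊛ p ⊖ X^ N) ⊛ f⁻ (suc k) ⊛ G)           ≈⟨ factor C (X^ N) p (f⁻ (suc k)) G ⟩
      X^ N ⊛ (C ⊛ ((p ⊖ one) ⊛ f⁻ (suc k) ⊛ G))          ∎)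
      where
      open ≈-Reasoning
      C = X^ (L * N + K)
      p = X^ (suc k)
      m₂ = N + suc k
      G = qbinom (N + N) r
      factor : ∀ c s p f g → c ⊛ ((s ⊛ p ⊖ s) ⊛ f ⊛ g) ≈ s ⊛ (c ⊛ ((p ⊖ one) ⊛ f ⊛ g))
      factor = solve 5 (λ c s p f g → c :* ((s :* p :- s) :* f :* g) := s :* (c :* ((p :- con (+ 1)) :* f :* g))) ≈-refl

    H-pair : ∀ {N} r k d → X^ (suc k) ⊛ d ≈ X^ (suc k) ⊛ f⁺ (suc k) ⊖ f⁻ (suc k) → r + suc k ≡ N →
      H N r ⊕ H N (N + suc k) ≈ X^ (L * N + K) ⊛ ((one ⊖ X^ (suc k)) ⊛ d ⊛ qbinom (N + N) r)
    H-pair {N} r k d pd≈ r+1+k≡N = X^-cancelˡ (suc k) (begin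
      p ⊛ (H N r ⊕ H N (N + suc k))
        ≈⟨ ⊛-distribˡ p (H N r) (H N (N + suc k)) ⟩
      p ⊛ H N r ⊕ p ⊛ H N (N + suc k)
        ≈⟨ ⊕-cong (⊛-congˡ p (H-below r k r+1+k≡N)) (H-above r k r+1+k≡N) ⟩
      p ⊛ (C ⊛ ((one ⊖ p) ⊛ f⁺ (suc k) ⊛ G)) ⊕ C ⊛ ((p ⊖ one) ⊛ f⁻ (suc k) ⊛ G)
        ≈⟨ combine C p (f⁺ (suc k)) (f⁻ (suc k)) G ⟩
      C ⊛ (one ⊖ p) ⊛ G ⊛ (p ⊛ f⁺ (suc k) ⊖ f⁻ (suc k))
        ≈⟨ ⊛-congˡ (C ⊛ (one ⊖ p) ⊛ G) pd≈ ⟨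
      C ⊛ (one ⊖ p) ⊛ G ⊛ (p ⊛ d)
        ≈⟨ regroup C p d G ⟩
      p ⊛ (C ⊛ ((one ⊖ p) ⊛ d ⊛ G)) ∎)
      where
      open ≈-Reasoning
      C = X^ (L * N + K)
      p = X^ (suc k)
      G = qbinom (N + N) r
      combine : ∀ c p f f′ g → p ⊛ (c ⊛ ((one ⊖ p) ⊛ f ⊛ g)) ⊕ c ⊛ ((p ⊖ one) ⊛ f′ ⊛ g)
                               ≈ c ⊛ (one ⊖ p) ⊛ g ⊛ (p ⊛ f ⊖ f′)
      combine = solve 5 (λ c p f f′ g →
        p :* (c :* ((con (+ 1) :- p) :* f :* g)) :+ c :* ((p :- con (+ 1)) :* f′ :* g)
          := c :* (con (+ 1) :- p) :* g :* (p :* f :- f′)) ≈-refl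
      regroup : ∀ c p d g → c ⊛ (one ⊖ p) ⊛ g ⊛ (p ⊛ d) ≈ p ⊛ (c ⊛ ((one ⊖ p) ⊛ d ⊛ g))
      regroup = solve 4 (λ c p d g →
        c :* (con (+ 1) :- p) :* g :* (p :* d) := p :* (c :* ((con (+ 1) :- p) :* d :* g))) ≈-refl

    sumPS-H : ∀ N → sumPS (N + N) (H N) ≈ X^ (L * N + K) ⊛ Θ 0 (N + N) N ⊖ X^ N ⊛ Θ ℓ (N + N) (3 + N)
    sumPS-H N = begin
      sumPS (N + N) (H N)
        ≈⟨ sumPS-distrib-⊕ (N + N) (λ m → C ⊛ θ 0 (N + N) N m) (λ m → neg (X^ N ⊛ θ ℓ (N + N) (3 + N) m)) ⟩
      sumPS (N + N) (λ m → C ⊛ θ 0 (N + N) N m) ⊕ sumPS (N + N) (λ m → neg (X^ N ⊛ θ ℓ (N + N) (3 + N) m))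
        ≈⟨ ⊕-congˡ (sumPS (N + N) (λ m → C ⊛ θ 0 (N + N) N m)) (sumPS-neg (N + N) (λ m → X^ N ⊛ θ ℓ (N + N) (3 + N) m)) ⟩
      sumPS (N + N) (λ m → C ⊛ θ 0 (N + N) N m) ⊖ sumPS (N + N) (λ m → X^ N ⊛ θ ℓ (N + N) (3 + N) m)
        ≈⟨ ⊕-cong (⊛-distribˡ-sumPS (N + N) C (θ 0 (N + N) N))
                  (neg-cong (⊛-distribˡ-sumPS (N + N) (X^ N) (θ ℓ (N + N) (3 + N)))) ⟨
      C ⊛ Θ 0 (N + N) N ⊖ X^ N ⊛ Θ ℓ (N + N) (3 + N) ∎
      where
      open ≈-Reasoning
      C = X^ (L * N + K)

    -- The hypothesis says D k = f (k + 1) - q^(-k-1) f (-k-1).  The terms m = n - k and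
    -- m = N + 1 + k of Σ_m H N m carry the same q-binomial and add up to the k-th term on the
    -- left; the middle term m = N vanishes.
    sum-via-Θ : ∀ (D : ℕ → PS) → (∀ k → X^ (suc k) ⊛ D k ≈ X^ (suc k) ⊛ f⁺ (suc k) ⊖ f⁻ (suc k)) → ∀ n →
      X^ (L * suc n + K) ⊛ sumPS n (λ k → (one ⊖ X^ (suc k)) ⊛ D k ⊛ qbinom (suc n + suc n) (n ∸ k))
        ≈ X^ (L * suc n + K) ⊛ Θ 0 (suc n + suc n) (suc n) ⊖ X^ (suc n) ⊛ Θ ℓ (suc n + suc n) (3 + suc n)
    sum-via-Θ D pD≈ n = begin
      C ⊛ sumPS n summand
        ≈⟨ ⊛-distribˡ-sumPS n C summand ⟩
      sumPS n (λ k → C ⊛ summand k)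
        ≈⟨ sumPS-cong-≤ n (λ k k≤n → H-pair (n ∸ k) k (D k) (pD≈ k) (index k≤n)) ⟨
      sumPS n (λ k → H N (n ∸ k) ⊕ H N (N + suc k))
        ≈⟨ sumPS-distrib-⊕ n (λ k → H N (n ∸ k)) (λ k → H N (N + suc k)) ⟩
      sumPS n (λ k → H N (n ∸ k)) ⊕ sumPS n (λ k → H N (N + suc k))
        ≈⟨ ⊕-cong (sumPS-reverse n (H N)) (sumPS-cong n λ k → ≈-reflexive (cong (H N) (sym (ℕ.+-suc N k)))) ⟨
      sumPS n (H N) ⊕ upper
        ≈⟨ ⊕-congʳ upper (≈-trans (⊕-congˡ (sumPS n (H N)) (H-middle N)) (⊕-identityʳ (sumPS n (H N)))) ⟨
      sumPS N (H N) ⊕ upper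
        ≈⟨ sumPS-++ N n (H N) ⟨
      sumPS (N + N) (H N)
        ≈⟨ sumPS-H N ⟩
      C ⊛ Θ 0 (N + N) N ⊖ X^ N ⊛ Θ ℓ (N + N) (3 + N) ∎
      where
      open ≈-Reasoning
      N = suc n
      C = X^ (L * N + K)
      summand : ℕ → PS
      summand k = (one ⊖ X^ (suc k)) ⊛ D k ⊛ qbinom (N + N) (n ∸ k)
      upper = sumPS n (λ k → H N (suc (N + k)))
      index : ∀ {k} → k ≤ n → n ∸ k + suc k ≡ N
      index {k} k≤n = trans (ℕ.+-suc (n ∸ k) k) (cong suc (ℕ.m∸n+n≡m k≤n))

-- Sequences satisfying a shift relation

iterate-shift : ∀ (g : ℕ → PS) (p : ℕ) (σ : ℕ → ℕ) → (∀ k → g (p + k) ≈ X^ (σ k) ⊛ g k) →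
  ∀ i (E : ℕ → ℕ) → E 0 ≡ 0 → (∀ r → σ (i + r * p) + E r ≡ E (suc r)) →
  ∀ r → g (i + r * p) ≈ X^ (E r) ⊛ g i
iterate-shift g p σ shift i E E0≡0 step zero = begin
  g (i + 0)          ≡⟨ cong g (ℕ.+-identityʳ i) ⟩
  g i                ≈⟨ ⊛-identityˡ (g i) ⟨
  one ⊛ g i          ≈⟨ ⊛-congʳ (g i) (≈-trans one≈X^0 (X^-cong (sym E0≡0))) ⟩
  X^ (E 0) ⊛ g i     ∎
  where open ≈-Reasoning
iterate-shift g p σ shift i E E0≡0 step (suc r) = begin
  g (i + suc r * p)                         ≡⟨ cong g (shift-index p i r) ⟩
  g (p + (i + r * p))                       ≈⟨ shift (i + r * p) ⟩
  X^ (σ (i + r * p)) ⊛ g (i + r * p)        ≈⟨ ⊛-congˡ (X^ (σ (i + r * p))) (iterate-shift g p σ shift i E E0≡0 step r) ⟩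
  X^ (σ (i + r * p)) ⊛ (X^ (E r) ⊛ g i)     ≈⟨ ⊛-assoc (X^ (σ (i + r * p))) (X^ (E r)) (g i) ⟨
  X^ (σ (i + r * p)) ⊛ X^ (E r) ⊛ g i       ≈⟨ ⊛-congʳ (g i) (X^⊛X^ (step r)) ⟩
  X^ (E (suc r)) ⊛ g i                      ∎
  where
  open ≈-Reasoning
  shift-index : ∀ p i r → i + suc r * p ≡ p + (i + r * p)
  shift-index = solve-∀

iterate-zero : ∀ (g : ℕ → PS) (p : ℕ) (σ : ℕ → ℕ) → (∀ k → g (p + k) ≈ X^ (σ k) ⊛ g k) →
  ∀ i → g i ≈ zeroPS → ∀ r → g (i + r * p) ≈ zeroPS
iterate-zero g p σ shift i gi≈0 r =
  ≈-trans (iterate-shift g p σ shift i E refl (λ _ → refl) r) (≈-trans (⊛-congˡ (X^ (E r)) gi≈0) (⊛-zeroʳ (X^ (E r))))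
  where
  E : ℕ → ℕ
  E zero    = 0
  E (suc r) = σ (i + r * p) + E r

mod-3-cases : ∀ (P : ℕ → ℕ → ℕ → Set) →
  (∀ r → P 0 r (r * 3)) → (∀ r → P 1 r (1 + r * 3)) → (∀ r → P 2 r (2 + r * 3)) →
  ∀ k → P (k % 3) (k / 3) k
mod-3-cases P h₀ h₁ h₂ k with k % 3 | m≡m%n+[m/n]*n k 3 | m%n<n k 3
... | 0                 | k≡ | _ = subst (P 0 (k / 3)) (sym k≡) (h₀ (k / 3))
... | 1                 | k≡ | _ = subst (P 1 (k / 3)) (sym k≡) (h₁ (k / 3))
... | 2                 | k≡ | _ = subst (P 2 (k / 3)) (sym k≡) (h₂ (k / 3))
... | suc (suc (suc _)) | _  | s≤s (s≤s (s≤s ()))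

∸-exact : ∀ {a b c} → a ≡ c + b → a ∸ b ≡ c
∸-exact {b = b} {c} a≡c+b = trans (cong (_∸ b) a≡c+b) (ℕ.m+n∸n≡m c b)

module FirstPair where

  -- f⁺ j = f j and f⁻ j = f (- j) for the two-sided sequence given for t ∈ ℤ by
  -- f (3t) = q^(3t² - 2t), f (3t + 1) = 0, f (3t + 2) = - q^(3t² + 2t).
  f⁺ : ℕ → PS
  f⁺ 0                      = one
  f⁺ 1                      = zeroPS
  f⁺ 2                      = neg one
  f⁺ (suc (suc (suc k)))    = X^ (2 * k + 1) ⊛ f⁺ k

  f⁻ : ℕ → PS
  f⁻ 0                      = one
  f⁻ 1                      = neg (X^ 1)
  f⁻ 2                      = zeroPS
  f⁻ (suc (suc (suc k)))    = X^ (2 * k + 5) ⊛ f⁻ k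

  D₃ : ℕ → ℕ → PS
  D₃ 0 r = X^ (3 * r * r + r)
  D₃ 1 r = neg (X^ (3 * r * r + 2 * r))
  D₃ _ r = X^ (3 * suc r * suc r ∸ 2 * suc r) ⊖ X^ (3 * suc r * suc r ∸ suc r)

  D : ℕ → PS
  D k = D₃ (k % 3) (k / 3)

  α₁≈fac⊛D : ∀ k → α₁ k ≈ fac k ⊛ D k
  α₁≈fac⊛D k with k % 3
  ... | 0           = ≈-refl
  ... | 1           = neg-distribʳ-⊛ (fac k) (X^ (3 * (k / 3) * (k / 3) + 2 * (k / 3)))
  ... | suc (suc _) = ≈-refl

  f⁻-shift : ∀ k → X^ 1 ⊛ f⁻ (3 + k) ≈ X^ (2 * (3 + k)) ⊛ f⁻ k
  f⁻-shift k = ≈-trans (≈-sym (⊛-assoc (X^ 1) (X^ (2 * k + 5)) (f⁻ k))) (⊛-congʳ (f⁻ k) (X^⊛X^ (exponent k)))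
    where
    exponent : ∀ k → 1 + (2 * k + 5) ≡ 2 * (3 + k)
    exponent = solve-∀

  f-shift₁ : X^ 2 ⊛ f⁺ 2 ≈ X^ 1 ⊛ f⁻ 1
  f-shift₁ = begin
    X^ 2 ⊛ neg one       ≈⟨ neg-distribʳ-⊛ (X^ 2) one ⟨
    neg (X^ 2 ⊛ one)     ≈⟨ neg-cong (⊛-identityʳ (X^ 2)) ⟩
    neg (X^ 2)           ≈⟨ X^⊛neg-X^ refl ⟨
    X^ 1 ⊛ neg (X^ 1)    ∎
    where open ≈-Reasoning

  f-shift₂ : X^ (2 * 2) ⊛ f⁺ 1 ≈ X^ 1 ⊛ f⁻ 2
  f-shift₂ = ≈-trans (⊛-zeroʳ (X^ 4)) (≈-sym (⊛-zeroʳ (X^ 1)))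

  f-shift₃ : X^ (2 * 3) ⊛ f⁺ 0 ≈ X^ 1 ⊛ f⁻ 3
  f-shift₃ = ≈-trans (⊛-congʳ one (≈-sym (X^⊛X^ refl))) (⊛-assoc (X^ 1) (X^ 5) one)

  open QuasiPeriodicSums f⁺ f⁻
  open QuasiPeriodicity 1 1 (λ _ → ≈-refl) f⁻-shift f-shift₁ f-shift₂ f-shift₃

  -- τ N = N (N - 1)
  τ : ℕ → ℕ
  τ zero    = 0
  τ (suc n) = n + n + τ n

  record Even (N : ℕ) : Set where
    field
      Θ₀[N]   : Θ 0 (N + N) N ≈ X^ (τ N)
      Θ₀[N+1] : Θ 0 (N + N) (1 + N) ≈ zeroPS
      Θ₁[N+2] : Θ 1 (N + N) (2 + N) ≈ neg (X^ (τ (suc N)))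
      Θ₁[N+3] : Θ 1 (N + N) (3 + N) ≈ X^ (suc (τ (suc N)))

  record Odd (N : ℕ) : Set where
    field
      Θ₀[N+1] : Θ 0 (1 + (N + N)) (1 + N) ≈ X^ (τ (suc N))
      Θ₀[N+2] : Θ 0 (1 + (N + N)) (2 + N) ≈ neg (X^ (τ (suc N)))
      Θ₁[N+2] : Θ 1 (1 + (N + N)) (2 + N) ≈ neg (X^ (τ (suc N)))
      Θ₁[N+3] : Θ 1 (1 + (N + N)) (3 + N) ≈ zeroPS

  even→odd : ∀ N → Even N → Odd N
  even→odd N e = record
    { Θ₀[N+1] = X^-cancelˡ E (begin
        X^ E ⊛ Θ 0 (1 + M) (1 + N)                     ≈⟨ Θ-shift 0 (1 + M) (1 + N) ⟨
        Θ 2 (1 + M) (4 + N)                            ≈⟨ Θ-pascal′ 1 M (3 + N) ⟩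
        X^ (2 + M) ⊛ Θ 1 M (3 + N) ⊕ Θ 2 M (4 + N)     ≈⟨ ⊕-cong (⊛-congˡ (X^ (2 + M)) Θ₁[N+3]) (Θ-shift 0 M (1 + N)) ⟩
        X^ (2 + M) ⊛ X^ (1 + t) ⊕ X^ E ⊛ Θ 0 M (1 + N) ≈⟨ ⊕-congˡ (X^ (2 + M) ⊛ X^ (1 + t)) (⊛-congˡ (X^ E) Θ₀[N+1]) ⟩
        X^ (2 + M) ⊛ X^ (1 + t) ⊕ X^ E ⊛ zeroPS        ≈⟨ ≈-trans (⊕-congˡ (X^ (2 + M) ⊛ X^ (1 + t)) (⊛-zeroʳ (X^ E)))
                                                                   (⊕-identityʳ (X^ (2 + M) ⊛ X^ (1 + t))) ⟩
        X^ (2 + M) ⊛ X^ (1 + t)                        ≈⟨ ≈-trans (X^⊛X^ (arith₁ N (τ N))) (X^-+ E t) ⟩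
        X^ E ⊛ X^ t                                    ∎)
    ; Θ₀[N+2] = begin
        Θ 0 (1 + M) (2 + N)                            ≈⟨ Θ-pascal 0 M (1 + N) ⟩
        X^ 0 ⊛ Θ 0 M (1 + N) ⊕ Θ 1 M (2 + N)           ≈⟨ ⊕-cong (⊛-congˡ (X^ 0) Θ₀[N+1]) Θ₁[N+2] ⟩
        X^ 0 ⊛ zeroPS ⊕ neg (X^ t)                     ≈⟨ ≈-trans (⊕-congʳ (neg (X^ t)) (⊛-zeroʳ (X^ 0))) (⊕-identityˡ (neg (X^ t))) ⟩
        neg (X^ t)                                     ∎
    ; Θ₁[N+2] = begin
        Θ 1 (1 + M) (2 + N)                            ≈⟨ Θ-pascal′ 0 M (1 + N) ⟩
        X^ (1 + M) ⊛ Θ 0 M (1 + N) ⊕ Θ 1 M (2 + N)     ≈⟨ ⊕-cong (⊛-congˡ (X^ (1 + M)) Θ₀[N+1]) Θ₁[N+2] ⟩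
        X^ (1 + M) ⊛ zeroPS ⊕ neg (X^ t)               ≈⟨ ≈-trans (⊕-congʳ (neg (X^ t)) (⊛-zeroʳ (X^ (1 + M)))) (⊕-identityˡ (neg (X^ t))) ⟩
        neg (X^ t)                                     ∎
    ; Θ₁[N+3] = begin
        Θ 1 (1 + M) (3 + N)                            ≈⟨ Θ-pascal 1 M (2 + N) ⟩
        X^ 1 ⊛ Θ 1 M (2 + N) ⊕ Θ 2 M (3 + N)           ≈⟨ ⊕-cong (⊛-congˡ (X^ 1) Θ₁[N+2]) (Θ-shift 0 M N) ⟩
        X^ 1 ⊛ neg (X^ t) ⊕ X^ (2 * N + 1) ⊛ Θ 0 M N   ≈⟨ ⊕-congˡ (X^ 1 ⊛ neg (X^ t)) (⊛-congˡ (X^ (2 * N + 1)) Θ₀[N]) ⟩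
        X^ 1 ⊛ neg (X^ t) ⊕ X^ (2 * N + 1) ⊛ X^ (τ N)  ≈⟨ ⊕-cong (X^⊛neg-X^ refl) (X^⊛X^ (arith₂ N (τ N))) ⟩
        neg (X^ (1 + t)) ⊕ X^ (1 + t)                  ≈⟨ solve 1 (λ x → :- x :+ x := con (+ 0)) ≈-refl (X^ (1 + t)) ⟩
        zeroPS                                         ∎
    }
    where
    open ≈-Reasoning
    open Even e
    M = N + N
    t = τ (suc N)
    E = 2 * suc N + 1
    arith₁ : ∀ N t → 2 + (N + N) + (1 + (N + N + t)) ≡ 2 * suc N + 1 + (N + N + t)
    arith₁ = solve-∀
    arith₂ : ∀ N t → 2 * N + 1 + t ≡ 1 + (N + N + t)
    arith₂ = solve-∀

  odd→even : ∀ N → Odd N → Even (suc N)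
  odd→even N o = record
    { Θ₀[N] = X^-cancelˡ E (begin
        X^ E ⊛ Θ 0 M′ (1 + N)                          ≡⟨ cong (λ M → X^ E ⊛ Θ 0 M (1 + N)) M′≡ ⟩
        X^ E ⊛ Θ 0 (2 + M) (1 + N)                     ≈⟨ Θ-shift 0 (2 + M) (1 + N) ⟨
        Θ 2 (2 + M) (4 + N)                            ≈⟨ Θ-pascal′ 1 (1 + M) (3 + N) ⟩
        X^ (3 + M) ⊛ Θ 1 (1 + M) (3 + N) ⊕ Θ 2 (1 + M) (4 + N)
          ≈⟨ ⊕-cong (⊛-congˡ (X^ (3 + M)) Θ₁[N+3]) (Θ-shift 0 (1 + M) (1 + N)) ⟩
        X^ (3 + M) ⊛ zeroPS ⊕ X^ E ⊛ Θ 0 (1 + M) (1 + N)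
          ≈⟨ ⊕-congˡ (X^ (3 + M) ⊛ zeroPS) (⊛-congˡ (X^ E) Θ₀[N+1]) ⟩
        X^ (3 + M) ⊛ zeroPS ⊕ X^ E ⊛ X^ t              ≈⟨ ≈-trans (⊕-congʳ (X^ E ⊛ X^ t) (⊛-zeroʳ (X^ (3 + M))))
                                                                   (⊕-identityˡ (X^ E ⊛ X^ t)) ⟩
        X^ E ⊛ X^ t                                    ∎)
    ; Θ₀[N+1] = begin
        Θ 0 M′ (2 + N)                                 ≡⟨ cong (λ M → Θ 0 M (2 + N)) M′≡ ⟩
        Θ 0 (2 + M) (2 + N)                            ≈⟨ Θ-pascal 0 (1 + M) (1 + N) ⟩
        X^ 0 ⊛ Θ 0 (1 + M) (1 + N) ⊕ Θ 1 (1 + M) (2 + N) ≈⟨ ⊕-cong (⊛-cong (≈-sym one≈X^0) Θ₀[N+1]) Θ₁[N+2] ⟩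
        one ⊛ X^ t ⊕ neg (X^ t)                        ≈⟨ solve 1 (λ x → con (+ 1) :* x :- x := con (+ 0)) ≈-refl (X^ t) ⟩
        zeroPS                                         ∎
    ; Θ₁[N+2] = begin
        Θ 1 M′ (3 + N)                                 ≡⟨ cong (λ M → Θ 1 M (3 + N)) M′≡ ⟩
        Θ 1 (2 + M) (3 + N)                            ≈⟨ Θ-pascal′ 0 (1 + M) (2 + N) ⟩
        X^ (2 + M) ⊛ Θ 0 (1 + M) (2 + N) ⊕ Θ 1 (1 + M) (3 + N)
          ≈⟨ ⊕-cong (⊛-congˡ (X^ (2 + M)) Θ₀[N+2]) Θ₁[N+3] ⟩
        X^ (2 + M) ⊛ neg (X^ t) ⊕ zeroPS               ≈⟨ ⊕-identityʳ (X^ (2 + M) ⊛ neg (X^ t)) ⟩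
        X^ (2 + M) ⊛ neg (X^ t)                        ≈⟨ X^⊛neg-X^ (arith₁ N (τ N)) ⟩
        neg (X^ (τ (2 + N)))                           ∎
    ; Θ₁[N+3] = begin
        Θ 1 M′ (4 + N)                                 ≡⟨ cong (λ M → Θ 1 M (4 + N)) M′≡ ⟩
        Θ 1 (2 + M) (4 + N)                            ≈⟨ Θ-pascal 1 (1 + M) (3 + N) ⟩
        X^ 1 ⊛ Θ 1 (1 + M) (3 + N) ⊕ Θ 2 (1 + M) (4 + N)
          ≈⟨ ⊕-cong (⊛-congˡ (X^ 1) Θ₁[N+3]) (Θ-shift 0 (1 + M) (1 + N)) ⟩
        X^ 1 ⊛ zeroPS ⊕ X^ E ⊛ Θ 0 (1 + M) (1 + N)     ≈⟨ ⊕-congˡ (X^ 1 ⊛ zeroPS) (⊛-congˡ (X^ E) Θ₀[N+1]) ⟩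
        X^ 1 ⊛ zeroPS ⊕ X^ E ⊛ X^ t                    ≈⟨ ≈-trans (⊕-congʳ (X^ E ⊛ X^ t) (⊛-zeroʳ (X^ 1))) (⊕-identityˡ (X^ E ⊛ X^ t)) ⟩
        X^ E ⊛ X^ t                                    ≈⟨ X^⊛X^ (arith₂ N (τ N)) ⟩
        X^ (suc (τ (2 + N)))                           ∎
    }
    where
    open ≈-Reasoning
    open Odd o
    M = N + N
    M′ = suc N + suc N
    M′≡ : M′ ≡ 2 + M
    M′≡ = cong suc (ℕ.+-suc N N)
    t = τ (suc N)
    E = 2 * suc N + 1
    arith₁ : ∀ N t → 2 + (N + N) + (N + N + t) ≡ suc N + suc N + (N + N + t)
    arith₁ = solve-∀
    arith₂ : ∀ N t → 2 * suc N + 1 + (N + N + t) ≡ suc (suc N + suc N + (N + N + t))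
    arith₂ = solve-∀

  even : ∀ N → Even N
  even zero    = record
    { Θ₀[N]   = ≈-trans (Θ-zero 0 0) one≈X^0
    ; Θ₀[N+1] = Θ-zero 0 1
    ; Θ₁[N+2] = ≈-trans (Θ-zero 1 2) (neg-cong one≈X^0)
    ; Θ₁[N+3] = ≈-trans (Θ-zero 1 3) (⊛-identityʳ (X^ 1))
    }
  even (suc N) = odd→even N (even→odd N (even N))

  f⁺[1+3r] : ∀ r → f⁺ (1 + r * 3) ≈ zeroPS
  f⁺[1+3r] = iterate-zero f⁺ 3 (λ k → 2 * k + 1) (λ _ → ≈-refl) 1 ≈-refl

  f⁺[2+3r] : ∀ r → f⁺ (2 + r * 3) ≈ X^ (3 * r * r + 2 * r) ⊛ neg one
  f⁺[2+3r] = iterate-shift f⁺ 3 (λ k → 2 * k + 1) (λ _ → ≈-refl) 2 (λ r → 3 * r * r + 2 * r) refl solve-∀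

  f⁺[3+3r] : ∀ r → f⁺ (3 + r * 3) ≈ X^ (3 * r * r + 4 * r) ⊛ (X^ 1 ⊛ one)
  f⁺[3+3r] = iterate-shift f⁺ 3 (λ k → 2 * k + 1) (λ _ → ≈-refl) 3 (λ r → 3 * r * r + 4 * r) refl solve-∀

  f⁻[1+3r] : ∀ r → f⁻ (1 + r * 3) ≈ X^ (3 * r * r + 4 * r) ⊛ neg (X^ 1)
  f⁻[1+3r] = iterate-shift f⁻ 3 (λ k → 2 * k + 5) (λ _ → ≈-refl) 1 (λ r → 3 * r * r + 4 * r) refl solve-∀

  f⁻[2+3r] : ∀ r → f⁻ (2 + r * 3) ≈ zeroPS
  f⁻[2+3r] = iterate-zero f⁻ 3 (λ k → 2 * k + 5) (λ _ → ≈-refl) 2 ≈-refl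

  f⁻[3+3r] : ∀ r → f⁻ (3 + r * 3) ≈ X^ (3 * r * r + 8 * r) ⊛ (X^ 5 ⊛ one)
  f⁻[3+3r] = iterate-shift f⁻ 3 (λ k → 2 * k + 5) (λ _ → ≈-refl) 3 (λ r → 3 * r * r + 8 * r) refl solve-∀

  D-shift₀ : ∀ r → X^ (1 + r * 3) ⊛ D₃ 0 r ≈ X^ (1 + r * 3) ⊛ f⁺ (1 + r * 3) ⊖ f⁻ (1 + r * 3)
  D-shift₀ r = begin
    X^ (1 + r * 3) ⊛ X^ (3 * r * r + r)          ≈⟨ X^⊛X^ (arith r) ⟩
    X^ e                                         ≈⟨ solve 2 (λ x y → x := y :* con (+ 0) :- (:- x)) ≈-refl (X^ e) (X^ (1 + r * 3)) ⟩
    X^ (1 + r * 3) ⊛ zeroPS ⊖ neg (X^ e)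
      ≈⟨ ⊕-cong (⊛-congˡ (X^ (1 + r * 3)) (f⁺[1+3r] r)) (neg-cong (≈-trans (f⁻[1+3r] r) (X^⊛neg-X^ refl))) ⟨
    X^ (1 + r * 3) ⊛ f⁺ (1 + r * 3) ⊖ f⁻ (1 + r * 3) ∎
    where
    open ≈-Reasoning
    e = 3 * r * r + 4 * r + 1
    arith : ∀ r → 1 + r * 3 + (3 * r * r + r) ≡ 3 * r * r + 4 * r + 1
    arith = solve-∀

  D-shift₁ : ∀ r → X^ (2 + r * 3) ⊛ D₃ 1 r ≈ X^ (2 + r * 3) ⊛ f⁺ (2 + r * 3) ⊖ f⁻ (2 + r * 3)
  D-shift₁ r = begin
    X^ (2 + r * 3) ⊛ neg (X^ a)
      ≈⟨ solve 2 (λ x y → x :* (:- y) := x :* (y :* (:- con (+ 1))) :- con (+ 0)) ≈-refl (X^ (2 + r * 3)) (X^ a) ⟩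
    X^ (2 + r * 3) ⊛ (X^ a ⊛ neg one) ⊖ zeroPS
      ≈⟨ ⊕-cong (⊛-congˡ (X^ (2 + r * 3)) (f⁺[2+3r] r)) (neg-cong (f⁻[2+3r] r)) ⟨
    X^ (2 + r * 3) ⊛ f⁺ (2 + r * 3) ⊖ f⁻ (2 + r * 3) ∎
    where
    open ≈-Reasoning
    a = 3 * r * r + 2 * r

  D-shift₂ : ∀ r → X^ (3 + r * 3) ⊛ D₃ 2 r ≈ X^ (3 + r * 3) ⊛ f⁺ (3 + r * 3) ⊖ f⁻ (3 + r * 3)
  D-shift₂ r = begin
    X^ p ⊛ (X^ (3 * suc r * suc r ∸ 2 * suc r) ⊖ X^ (3 * suc r * suc r ∸ suc r))
      ≈⟨ ⊛-congˡ (X^ p) (⊕-cong (X^-cong (∸-exact (arith₁ r))) (neg-cong (X^-cong (∸-exact (arith₂ r))))) ⟩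
    X^ p ⊛ (X^ a ⊖ X^ b)
      ≈⟨ solve 3 (λ x y z → x :* (y :- z) := x :* y :- x :* z) ≈-refl (X^ p) (X^ a) (X^ b) ⟩
    X^ p ⊛ X^ a ⊖ X^ p ⊛ X^ b
      ≈⟨ ⊕-cong (⊛-congˡ (X^ p) f⁺[p]) (neg-cong f⁻[p]) ⟨
    X^ p ⊛ f⁺ p ⊖ f⁻ p ∎
    where
    open ≈-Reasoning
    p = 3 + r * 3
    a = 3 * r * r + 4 * r + 1
    b = 3 * r * r + 5 * r + 2
    arith₁ : ∀ r → 3 * suc r * suc r ≡ 3 * r * r + 4 * r + 1 + 2 * suc r
    arith₁ = solve-∀
    arith₂ : ∀ r → 3 * suc r * suc r ≡ 3 * r * r + 5 * r + 2 + suc r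
    arith₂ = solve-∀
    f⁺[p] : f⁺ p ≈ X^ a
    f⁺[p] = ≈-trans (f⁺[3+3r] r) (≈-trans (⊛-congˡ (X^ (3 * r * r + 4 * r)) (⊛-identityʳ (X^ 1))) (X^⊛X^ refl))
    f⁻[p] : f⁻ p ≈ X^ p ⊛ X^ b
    f⁻[p] = ≈-trans (f⁻[3+3r] r) (≈-trans (⊛-congˡ (X^ (3 * r * r + 8 * r)) (⊛-identityʳ (X^ 5)))
                                   (≈-trans (X^⊛X^ (arith₄ r)) (X^-+ p b)))
      where
      arith₄ : ∀ r → 3 * r * r + 8 * r + 5 ≡ 3 + r * 3 + (3 * r * r + 5 * r + 2)
      arith₄ = solve-∀

  D-shift : ∀ k → X^ (suc k) ⊛ D k ≈ X^ (suc k) ⊛ f⁺ (suc k) ⊖ f⁻ (suc k)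
  D-shift = mod-3-cases (λ i r k → X^ (suc k) ⊛ D₃ i r ≈ X^ (suc k) ⊛ f⁺ (suc k) ⊖ f⁻ (suc k))
                        D-shift₀ D-shift₁ D-shift₂

  τ-suc : ∀ n → τ (suc n) ≡ n * n + n
  τ-suc zero    = refl
  τ-suc (suc n) = trans (cong (λ t → suc n + suc n + t) (τ-suc n)) (arith n)
    where
    arith : ∀ n → suc n + suc n + (n * n + n) ≡ suc n * suc n + suc n
    arith = solve-∀

  polynomial-identity : ∀ n → sumPS n (λ k → (one ⊖ X^ (suc k)) ⊛ D k ⊛ qbinom (suc n + suc n) (n ∸ k))
                                ≈ X^ (n * n + n) ⊛ (one ⊖ X^ (suc n))
  polynomial-identity n = X^-cancelˡ E (begin
    X^ E ⊛ sumPS n (λ k → (one ⊖ X^ (suc k)) ⊛ D k ⊛ qbinom (N + N) (n ∸ k))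
      ≈⟨ sum-via-Θ D D-shift n ⟩
    X^ E ⊛ Θ 0 (N + N) N ⊖ X^ N ⊛ Θ 1 (N + N) (3 + N)
      ≈⟨ ⊕-cong (⊛-congˡ (X^ E) Θ₀[N]) (neg-cong (⊛-congˡ (X^ N) Θ₁[N+3])) ⟩
    X^ E ⊛ X^ (τ N) ⊖ X^ N ⊛ X^ (suc (τ (suc N)))
      ≈⟨ ⊕-congˡ (X^ E ⊛ X^ (τ N)) (neg-cong (≈-trans (X^⊛X^ (arith N (τ N))) (≈-sym (X^⊛X^⊛X^ refl)))) ⟩
    X^ E ⊛ X^ (τ N) ⊖ X^ E ⊛ X^ (τ N) ⊛ X^ N
      ≈⟨ solve 3 (λ x y z → x :* y :- x :* y :* z := x :* (y :* (con (+ 1) :- z))) ≈-refl (X^ E) (X^ (τ N)) (X^ N) ⟩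
    X^ E ⊛ (X^ (τ N) ⊛ (one ⊖ X^ N))
      ≈⟨ ⊛-congˡ (X^ E) (⊛-congʳ (one ⊖ X^ N) (X^-cong (τ-suc n))) ⟩
    X^ E ⊛ (X^ (n * n + n) ⊛ (one ⊖ X^ N)) ∎)
    where
    open ≈-Reasoning
    open Even (even (suc n))
    N = suc n
    E = 2 * N + 1
    arith : ∀ N t → N + suc (N + N + t) ≡ 2 * N + 1 + t + N
    arith = solve-∀

  bailey-pair : BaileyPair (X^ 2) α₁ β₁
  bailey-pair = bailey-pair-of-identity D (λ n → X^ (n * n + n)) α₁≈fac⊛D (λ _ → ≈-refl) polynomial-identity

module SecondPair where

  -- f⁺ j = f j and f⁻ j = f (- j) for the two-sided sequence given for t ∈ ℤ by
  -- f (3t) = q^(6t² - t), f (3t + 1) = 0, f (3t + 2) = - q^(6t² + 7t + 2).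
  f⁺ : ℕ → PS
  f⁺ 0                      = one
  f⁺ 1                      = zeroPS
  f⁺ 2                      = neg (X^ 2)
  f⁺ (suc (suc (suc k)))    = X^ (4 * k + 5) ⊛ f⁺ k

  f⁻ : ℕ → PS
  f⁻ 0                      = one
  f⁻ 1                      = neg (X^ 1)
  f⁻ 2                      = zeroPS
  f⁻ (suc (suc (suc k)))    = X^ (4 * k + 7) ⊛ f⁻ k

  D₃ : ℕ → ℕ → PS
  D₃ 0 r = X^ (6 * r * r + 2 * r)
  D₃ 1 r = neg (X^ (6 * r * r + 7 * r + 2))
  D₃ _ r = X^ (6 * suc r * suc r ∸ suc r) ⊖ X^ (6 * suc r * suc r ∸ 2 * suc r)

  D : ℕ → PS
  D k = D₃ (k % 3) (k / 3)

  α₂≈fac⊛D : ∀ k → α₂ k ≈ fac k ⊛ D k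
  α₂≈fac⊛D k with k % 3
  ... | 0           = ≈-refl
  ... | 1           = neg-distribʳ-⊛ (fac k) (X^ (6 * (k / 3) * (k / 3) + 7 * (k / 3) + 2))
  ... | suc (suc _) = ≈-refl

  f⁻-shift : ∀ k → X^ 5 ⊛ f⁻ (3 + k) ≈ X^ (4 * (3 + k)) ⊛ f⁻ k
  f⁻-shift k = ≈-trans (≈-sym (⊛-assoc (X^ 5) (X^ (4 * k + 7)) (f⁻ k))) (⊛-congʳ (f⁻ k) (X^⊛X^ (exponent k)))
    where
    exponent : ∀ k → 5 + (4 * k + 7) ≡ 4 * (3 + k)
    exponent = solve-∀

  f-shift₁ : X^ 4 ⊛ f⁺ 2 ≈ X^ 5 ⊛ f⁻ 1
  f-shift₁ = ≈-trans (X^⊛neg-X^ refl) (≈-sym (X^⊛neg-X^ refl))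

  f-shift₂ : X^ (4 * 2) ⊛ f⁺ 1 ≈ X^ 5 ⊛ f⁻ 2
  f-shift₂ = ≈-trans (⊛-zeroʳ (X^ 8)) (≈-sym (⊛-zeroʳ (X^ 5)))

  f-shift₃ : X^ (4 * 3) ⊛ f⁺ 0 ≈ X^ 5 ⊛ f⁻ 3
  f-shift₃ = ≈-trans (⊛-congʳ one (≈-sym (X^⊛X^ refl))) (⊛-assoc (X^ 5) (X^ 7) one)

  open QuasiPeriodicSums f⁺ f⁻
  open QuasiPeriodicity 3 5 (λ _ → ≈-refl) f⁻-shift f-shift₁ f-shift₂ f-shift₃

  record Even (N : ℕ) : Set where
    field
      Θ₀[N]   : Θ 0 (N + N) N ≈ one
      Θ₁[N+1] : Θ 1 (N + N) (1 + N) ≈ zeroPS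
      Θ₂[N+2] : Θ 2 (N + N) (2 + N) ≈ neg (X^ (2 + (N + N)))
      Θ₃[N+3] : Θ 3 (N + N) (3 + N) ≈ X^ (4 * N + 5)

  record Odd (N : ℕ) : Set where
    field
      Θ₀[N+1] : Θ 0 (1 + (N + N)) (1 + N) ≈ one
      Θ₁[N+1] : Θ 1 (1 + (N + N)) (1 + N) ≈ X^ (1 + (N + N))
      Θ₂[N+2] : Θ 2 (1 + (N + N)) (2 + N) ≈ neg (X^ (2 + (N + N)))
      Θ₃[N+3] : Θ 3 (1 + (N + N)) (3 + N) ≈ zeroPS

  even→odd : ∀ N → Even N → Odd N
  even→odd N e = record
    { Θ₀[N+1] = begin
        Θ 0 (1 + M) (1 + N)                            ≈⟨ Θ-pascal 0 M N ⟩
        X^ 0 ⊛ Θ 0 M N ⊕ Θ 1 M (1 + N)                 ≈⟨ ⊕-cong (⊛-cong (≈-sym one≈X^0) Θ₀[N]) Θ₁[N+1] ⟩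
        one ⊛ one ⊕ zeroPS                             ≈⟨ solve 0 (con (+ 1) :* con (+ 1) :+ con (+ 0) := con (+ 1)) ≈-refl ⟩
        one                                            ∎
    ; Θ₁[N+1] = begin
        Θ 1 (1 + M) (1 + N)                            ≈⟨ Θ-pascal′ 0 M N ⟩
        X^ (1 + M) ⊛ Θ 0 M N ⊕ Θ 1 M (1 + N)           ≈⟨ ⊕-cong (⊛-congˡ (X^ (1 + M)) Θ₀[N]) Θ₁[N+1] ⟩
        X^ (1 + M) ⊛ one ⊕ zeroPS                      ≈⟨ ≈-trans (⊕-identityʳ (X^ (1 + M) ⊛ one)) (⊛-identityʳ (X^ (1 + M))) ⟩
        X^ (1 + M)                                     ∎
    ; Θ₂[N+2] = begin
        Θ 2 (1 + M) (2 + N)                            ≈⟨ Θ-pascal′ 1 M (1 + N) ⟩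
        X^ (2 + M) ⊛ Θ 1 M (1 + N) ⊕ Θ 2 M (2 + N)     ≈⟨ ⊕-cong (⊛-congˡ (X^ (2 + M)) Θ₁[N+1]) Θ₂[N+2] ⟩
        X^ (2 + M) ⊛ zeroPS ⊕ neg (X^ (2 + M))         ≈⟨ ≈-trans (⊕-congʳ (neg (X^ (2 + M))) (⊛-zeroʳ (X^ (2 + M))))
                                                                   (⊕-identityˡ (neg (X^ (2 + M)))) ⟩
        neg (X^ (2 + M))                               ∎
    ; Θ₃[N+3] = begin
        Θ 3 (1 + M) (3 + N)                            ≈⟨ Θ-pascal′ 2 M (2 + N) ⟩
        X^ (3 + M) ⊛ Θ 2 M (2 + N) ⊕ Θ 3 M (3 + N)     ≈⟨ ⊕-cong (⊛-congˡ (X^ (3 + M)) Θ₂[N+2]) Θ₃[N+3] ⟩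
        X^ (3 + M) ⊛ neg (X^ (2 + M)) ⊕ X^ (4 * N + 5) ≈⟨ ⊕-congʳ (X^ (4 * N + 5)) (X^⊛neg-X^ (arith N)) ⟩
        neg (X^ (4 * N + 5)) ⊕ X^ (4 * N + 5)          ≈⟨ solve 1 (λ x → :- x :+ x := con (+ 0)) ≈-refl (X^ (4 * N + 5)) ⟩
        zeroPS                                         ∎
    }
    where
    open ≈-Reasoning
    open Even e
    M = N + N
    arith : ∀ N → 3 + (N + N) + (2 + (N + N)) ≡ 4 * N + 5
    arith = solve-∀

  odd→even : ∀ N → Odd N → Even (suc N)
  odd→even N o = record
    { Θ₀[N] = X^-cancelˡ E (begin
        X^ E ⊛ Θ 0 M′ (1 + N)                          ≡⟨ cong (λ M → X^ E ⊛ Θ 0 M (1 + N)) M′≡ ⟩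
        X^ E ⊛ Θ 0 (2 + M) (1 + N)                     ≈⟨ Θ-shift 0 (2 + M) (1 + N) ⟨
        Θ 4 (2 + M) (4 + N)                            ≈⟨ Θ-pascal′ 3 (1 + M) (3 + N) ⟩
        X^ (5 + M) ⊛ Θ 3 (1 + M) (3 + N) ⊕ Θ 4 (1 + M) (4 + N)
          ≈⟨ ⊕-cong (⊛-congˡ (X^ (5 + M)) Θ₃[N+3]) (Θ-shift 0 (1 + M) (1 + N)) ⟩
        X^ (5 + M) ⊛ zeroPS ⊕ X^ E ⊛ Θ 0 (1 + M) (1 + N)
          ≈⟨ ⊕-congˡ (X^ (5 + M) ⊛ zeroPS) (⊛-congˡ (X^ E) Θ₀[N+1]) ⟩
        X^ (5 + M) ⊛ zeroPS ⊕ X^ E ⊛ one               ≈⟨ ≈-trans (⊕-congʳ (X^ E ⊛ one) (⊛-zeroʳ (X^ (5 + M))))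
                                                                   (⊕-identityˡ (X^ E ⊛ one)) ⟩
        X^ E ⊛ one                                     ∎)
    ; Θ₁[N+1] = begin
        Θ 1 M′ (2 + N)                                 ≡⟨ cong (λ M → Θ 1 M (2 + N)) M′≡ ⟩
        Θ 1 (2 + M) (2 + N)                            ≈⟨ Θ-pascal 1 (1 + M) (1 + N) ⟩
        X^ 1 ⊛ Θ 1 (1 + M) (1 + N) ⊕ Θ 2 (1 + M) (2 + N) ≈⟨ ⊕-cong (⊛-congˡ (X^ 1) Θ₁[N+1]) Θ₂[N+2] ⟩
        X^ 1 ⊛ X^ (1 + M) ⊕ neg (X^ (2 + M))           ≈⟨ ⊕-congʳ (neg (X^ (2 + M))) (X^⊛X^ refl) ⟩
        X^ (2 + M) ⊕ neg (X^ (2 + M))                  ≈⟨ solve 1 (λ x → x :- x := con (+ 0)) ≈-refl (X^ (2 + M)) ⟩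
        zeroPS                                         ∎
    ; Θ₂[N+2] = begin
        Θ 2 M′ (3 + N)                                 ≡⟨ cong (λ M → Θ 2 M (3 + N)) M′≡ ⟩
        Θ 2 (2 + M) (3 + N)                            ≈⟨ Θ-pascal 2 (1 + M) (2 + N) ⟩
        X^ 2 ⊛ Θ 2 (1 + M) (2 + N) ⊕ Θ 3 (1 + M) (3 + N) ≈⟨ ⊕-cong (⊛-congˡ (X^ 2) Θ₂[N+2]) Θ₃[N+3] ⟩
        X^ 2 ⊛ neg (X^ (2 + M)) ⊕ zeroPS               ≈⟨ ⊕-identityʳ (X^ 2 ⊛ neg (X^ (2 + M))) ⟩
        X^ 2 ⊛ neg (X^ (2 + M))                        ≈⟨ X^⊛neg-X^ (cong (λ x → 2 + x) (sym M′≡)) ⟩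
        neg (X^ (2 + M′))                              ∎
    ; Θ₃[N+3] = begin
        Θ 3 M′ (4 + N)                                 ≡⟨ cong (λ M → Θ 3 M (4 + N)) M′≡ ⟩
        Θ 3 (2 + M) (4 + N)                            ≈⟨ Θ-pascal 3 (1 + M) (3 + N) ⟩
        X^ 3 ⊛ Θ 3 (1 + M) (3 + N) ⊕ Θ 4 (1 + M) (4 + N)
          ≈⟨ ⊕-cong (⊛-congˡ (X^ 3) Θ₃[N+3]) (Θ-shift 0 (1 + M) (1 + N)) ⟩
        X^ 3 ⊛ zeroPS ⊕ X^ E ⊛ Θ 0 (1 + M) (1 + N)     ≈⟨ ⊕-congˡ (X^ 3 ⊛ zeroPS) (⊛-congˡ (X^ E) Θ₀[N+1]) ⟩
        X^ 3 ⊛ zeroPS ⊕ X^ E ⊛ one                     ≈⟨ ≈-trans (⊕-congʳ (X^ E ⊛ one) (⊛-zeroʳ (X^ 3))) (⊕-identityˡ (X^ E ⊛ one)) ⟩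
        X^ E ⊛ one                                     ≈⟨ ⊛-identityʳ (X^ E) ⟩
        X^ E                                           ∎
    }
    where
    open ≈-Reasoning
    open Odd o
    M = N + N
    M′ = suc N + suc N
    M′≡ : M′ ≡ 2 + M
    M′≡ = cong suc (ℕ.+-suc N N)
    E = 4 * suc N + 5

  even : ∀ N → Even N
  even zero    = record
    { Θ₀[N]   = Θ-zero 0 0
    ; Θ₁[N+1] = Θ-zero 1 1
    ; Θ₂[N+2] = Θ-zero 2 2
    ; Θ₃[N+3] = ≈-trans (Θ-zero 3 3) (⊛-identityʳ (X^ 5))
    }
  even (suc N) = odd→even N (even→odd N (even N))

  f⁺[1+3r] : ∀ r → f⁺ (1 + r * 3) ≈ zeroPS
  f⁺[1+3r] = iterate-zero f⁺ 3 (λ k → 4 * k + 5) (λ _ → ≈-refl) 1 ≈-refl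

  f⁺[2+3r] : ∀ r → f⁺ (2 + r * 3) ≈ X^ (6 * r * r + 7 * r) ⊛ neg (X^ 2)
  f⁺[2+3r] = iterate-shift f⁺ 3 (λ k → 4 * k + 5) (λ _ → ≈-refl) 2 (λ r → 6 * r * r + 7 * r) refl solve-∀

  f⁺[3+3r] : ∀ r → f⁺ (3 + r * 3) ≈ X^ (6 * r * r + 11 * r) ⊛ (X^ 5 ⊛ one)
  f⁺[3+3r] = iterate-shift f⁺ 3 (λ k → 4 * k + 5) (λ _ → ≈-refl) 3 (λ r → 6 * r * r + 11 * r) refl solve-∀

  f⁻[1+3r] : ∀ r → f⁻ (1 + r * 3) ≈ X^ (6 * r * r + 5 * r) ⊛ neg (X^ 1)
  f⁻[1+3r] = iterate-shift f⁻ 3 (λ k → 4 * k + 7) (λ _ → ≈-refl) 1 (λ r → 6 * r * r + 5 * r) refl solve-∀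

  f⁻[2+3r] : ∀ r → f⁻ (2 + r * 3) ≈ zeroPS
  f⁻[2+3r] = iterate-zero f⁻ 3 (λ k → 4 * k + 7) (λ _ → ≈-refl) 2 ≈-refl

  f⁻[3+3r] : ∀ r → f⁻ (3 + r * 3) ≈ X^ (6 * r * r + 13 * r) ⊛ (X^ 7 ⊛ one)
  f⁻[3+3r] = iterate-shift f⁻ 3 (λ k → 4 * k + 7) (λ _ → ≈-refl) 3 (λ r → 6 * r * r + 13 * r) refl solve-∀

  D-shift₀ : ∀ r → X^ (1 + r * 3) ⊛ D₃ 0 r ≈ X^ (1 + r * 3) ⊛ f⁺ (1 + r * 3) ⊖ f⁻ (1 + r * 3)
  D-shift₀ r = begin
    X^ (1 + r * 3) ⊛ X^ (6 * r * r + 2 * r)      ≈⟨ X^⊛X^ (arith r) ⟩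
    X^ e                                         ≈⟨ solve 2 (λ x y → x := y :* con (+ 0) :- (:- x)) ≈-refl (X^ e) (X^ (1 + r * 3)) ⟩
    X^ (1 + r * 3) ⊛ zeroPS ⊖ neg (X^ e)
      ≈⟨ ⊕-cong (⊛-congˡ (X^ (1 + r * 3)) (f⁺[1+3r] r)) (neg-cong (≈-trans (f⁻[1+3r] r) (X^⊛neg-X^ refl))) ⟨
    X^ (1 + r * 3) ⊛ f⁺ (1 + r * 3) ⊖ f⁻ (1 + r * 3) ∎
    where
    open ≈-Reasoning
    e = 6 * r * r + 5 * r + 1
    arith : ∀ r → 1 + r * 3 + (6 * r * r + 2 * r) ≡ 6 * r * r + 5 * r + 1
    arith = solve-∀

  D-shift₁ : ∀ r → X^ (2 + r * 3) ⊛ D₃ 1 r ≈ X^ (2 + r * 3) ⊛ f⁺ (2 + r * 3) ⊖ f⁻ (2 + r * 3)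
  D-shift₁ r = begin
    X^ (2 + r * 3) ⊛ neg (X^ (6 * r * r + 7 * r + 2))
      ≈⟨ ⊛-congˡ (X^ (2 + r * 3)) (X^⊛neg-X^ refl) ⟨
    X^ (2 + r * 3) ⊛ (X^ (6 * r * r + 7 * r) ⊛ neg (X^ 2))
      ≈⟨ ⊕-identityʳ _ ⟨
    X^ (2 + r * 3) ⊛ (X^ (6 * r * r + 7 * r) ⊛ neg (X^ 2)) ⊖ zeroPS
      ≈⟨ ⊕-cong (⊛-congˡ (X^ (2 + r * 3)) (f⁺[2+3r] r)) (neg-cong (f⁻[2+3r] r)) ⟨
    X^ (2 + r * 3) ⊛ f⁺ (2 + r * 3) ⊖ f⁻ (2 + r * 3) ∎
    where open ≈-Reasoning

  D-shift₂ : ∀ r → X^ (3 + r * 3) ⊛ D₃ 2 r ≈ X^ (3 + r * 3) ⊛ f⁺ (3 + r * 3) ⊖ f⁻ (3 + r * 3)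
  D-shift₂ r = begin
    X^ p ⊛ (X^ (6 * suc r * suc r ∸ suc r) ⊖ X^ (6 * suc r * suc r ∸ 2 * suc r))
      ≈⟨ ⊛-congˡ (X^ p) (⊕-cong (X^-cong (∸-exact (arith₁ r))) (neg-cong (X^-cong (∸-exact (arith₂ r))))) ⟩
    X^ p ⊛ (X^ a ⊖ X^ b)
      ≈⟨ solve 3 (λ x y z → x :* (y :- z) := x :* y :- x :* z) ≈-refl (X^ p) (X^ a) (X^ b) ⟩
    X^ p ⊛ X^ a ⊖ X^ p ⊛ X^ b
      ≈⟨ ⊕-cong (⊛-congˡ (X^ p) f⁺[p]) (neg-cong f⁻[p]) ⟨
    X^ p ⊛ f⁺ p ⊖ f⁻ p ∎
    where
    open ≈-Reasoning
    p = 3 + r * 3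
    a = 6 * r * r + 11 * r + 5
    b = 6 * r * r + 10 * r + 4
    arith₁ : ∀ r → 6 * suc r * suc r ≡ 6 * r * r + 11 * r + 5 + suc r
    arith₁ = solve-∀
    arith₂ : ∀ r → 6 * suc r * suc r ≡ 6 * r * r + 10 * r + 4 + 2 * suc r
    arith₂ = solve-∀
    f⁺[p] : f⁺ p ≈ X^ a
    f⁺[p] = ≈-trans (f⁺[3+3r] r) (≈-trans (⊛-congˡ (X^ (6 * r * r + 11 * r)) (⊛-identityʳ (X^ 5))) (X^⊛X^ refl))
    f⁻[p] : f⁻ p ≈ X^ p ⊛ X^ b
    f⁻[p] = ≈-trans (f⁻[3+3r] r) (≈-trans (⊛-congˡ (X^ (6 * r * r + 13 * r)) (⊛-identityʳ (X^ 7)))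
                                   (≈-trans (X^⊛X^ (arith₃ r)) (X^-+ p b)))
      where
      arith₃ : ∀ r → 6 * r * r + 13 * r + 7 ≡ 3 + r * 3 + (6 * r * r + 10 * r + 4)
      arith₃ = solve-∀

  D-shift : ∀ k → X^ (suc k) ⊛ D k ≈ X^ (suc k) ⊛ f⁺ (suc k) ⊖ f⁻ (suc k)
  D-shift = mod-3-cases (λ i r k → X^ (suc k) ⊛ D₃ i r ≈ X^ (suc k) ⊛ f⁺ (suc k) ⊖ f⁻ (suc k))
                        D-shift₀ D-shift₁ D-shift₂

  polynomial-identity : ∀ n → sumPS n (λ k → (one ⊖ X^ (suc k)) ⊛ D k ⊛ qbinom (suc n + suc n) (n ∸ k))
                                ≈ one ⊛ (one ⊖ X^ (suc n))
  polynomial-identity n = X^-cancelˡ E (begin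
    X^ E ⊛ sumPS n (λ k → (one ⊖ X^ (suc k)) ⊛ D k ⊛ qbinom (N + N) (n ∸ k))
      ≈⟨ sum-via-Θ D D-shift n ⟩
    X^ E ⊛ Θ 0 (N + N) N ⊖ X^ N ⊛ Θ 3 (N + N) (3 + N)
      ≈⟨ ⊕-cong (⊛-congˡ (X^ E) Θ₀[N]) (neg-cong (⊛-congˡ (X^ N) Θ₃[N+3])) ⟩
    X^ E ⊛ one ⊖ X^ N ⊛ X^ E
      ≈⟨ solve 2 (λ x y → x :* con (+ 1) :- y :* x := x :* (con (+ 1) :* (con (+ 1) :- y))) ≈-refl (X^ E) (X^ N) ⟩
    X^ E ⊛ (one ⊛ (one ⊖ X^ N)) ∎)
    where
    open ≈-Reasoning
    open Even (even (suc n))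
    N = suc n
    E = 4 * N + 5

  bailey-pair : BaileyPair (X^ 2) α₂ β₂
  bailey-pair = bailey-pair-of-identity D (λ _ → one) α₂≈fac⊛D β₂≈ polynomial-identity
    where
    β₂≈ : ∀ n → β₂ n ≈ one ⊛ (one ⊕ X^ 1) ⊛ inv (poch (X^ 2) (2 * n)) ⊛ inv (one ⊕ X^ (suc n))
    β₂≈ n = ⊛-congʳ (inv (one ⊕ X^ (suc n)))
              (⊛-congʳ (inv (poch (X^ 2) (2 * n))) (≈-sym (⊛-identityˡ (one ⊕ X^ 1))))

lemma2p6 : BaileyPair (X^ 2) α₁ β₁ × BaileyPair (X^ 2) α₂ β₂
lemma2p6 = FirstPair.bailey-pair , SecondPair.bailey-pair
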